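{- For every parity game $\mathcal{G}$ (with at least one vertex) and every set $T$ of tangles of $\mathcal{G}$, the procedure \texttt{search}$(\mathcal{G},T)$ described below terminates and returns a pair $(T'',t)$ where $t$ is a tangle that is a dominion of $\mathcal{G}$.
   Context: Parity games: $\mathcal{G}=(V_0,V_1,E,\mathsf{pr})$ with finite $V=V_0\cup V_1$ (Even owns $V_0$, Odd owns $V_1$), left-total $E\subseteq V\times V$, $\mathsf{pr}:V\to\{0,\dots,d\}$; plays are infinite paths, won by Even iff the highest priority seen infinitely often is even; $\overline{\alpha}$ is the opponent of $\alpha$; strategies are partial functions $\sigma\subseteq E$ on $V_\alpha$. A dominion of player $\alpha$ is a set $D\subseteq V$ for which $\alpha$ has a strategy such that all consistent plays from $D$ stay in $D$ and are won by $\alpha$. A $p$-tangle is a nonempty $U\subseteq V$ with $p=\max\mathsf{pr}(U)$ and a witness strategy $\sigma_T(U):U\cap V_\alpha\to U$ of player $\alpha\equiv p\pmod 2$ such that $(U, E\cap(\sigma_T(U)\cup((U\cap V_{\overline\alpha})\times U)))$ is strongly connected and all its cycles have highest priority of parity $\alpha$. For a tangle $t$ of $\alpha$, $E_T(t)=\{v\in V\setminus t\mid \exists u\in t\cap V_{\overline\alpha}, (u,v)\in E\}$ (edges taken in the full game $\mathcal{G}$). For $U\subseteq V$, $\mathcal{G}\cap U$ is the subgame induced by $U$, and for a set of tangles $T$, $T\cap U=\{t\in T\mid t\subseteq U\}$. Tangle attractor: for a game $\mathcal{G}'$ with vertices $V'$, a set $T'$ of tangles and $A\subseteq V'$, $\mathit{TAttr}^{\mathcal{G}',T'}_\alpha(A)$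 is the least fixed point $Z$ of $Z=A\cup\{v\in V'_\alpha\mid E(v)\cap Z\ne\emptyset\}\cup\{v\in V'_{\overline\alpha}\mid E(v)\subseteq Z\}\cup\{v\in t\mid t\in T',\ \mathsf{pr}(t)\equiv\alpha \pmod 2,\ E_T(t)\neq\emptyset,\ E_T(t)\subseteq Z\}$ (with edges in $\mathcal{G}'$). It also yields a strategy $\sigma$ of $\alpha$: when an $\alpha$-vertex is added because of a successor in $Z$, $\sigma$ picks that successor; $\alpha$-vertices of $A$ get a successor in $Z$ when the backward search finds one; when the vertices of a tangle $t$ are added (tangles processed one at a time), $\sigma$ is extended by $\{(u,v)\in\sigma_T(t)\mid u\notin\mathrm{dom}(\sigma)\}$. \texttt{extract-tangles}$(Z,\sigma)$: compute the greatest $X\subseteq Z$ with $X=Z\cap(\{v\in V_{\overline\alpha}\mid E'(v)\subseteq X\}\cup\{v\in V_\alpha\mid\sigma(v)\in X\})$, where $E'$ are edges of the current subgame $\mathcal{G}'$; return the set of nontrivial bottom strongly connected components of the graph on $X$ whose edges are all $E'$-edges from $\overline\alpha$-vertices and the $\sigma$-edges from $\alpha$-vertices, each with witness strategy $\sigma$ restricted to it. \texttt{search}$(\mathcal{G},T)$: repeat forever: set the region function $\mathsf{r}:=\emptyset$ (a partial map $V\to\{0,\dots,d\}$) and $Y:=\emptyset$; while $V\setminus\mathrm{dom}(\mathsf{r})\ne\emptyset$: let $\mathcal{G}'=\mathcal{G}\cap(V\setminus\mathrm{dom}(\mathsf{r}))$, $T'=T\cap(V\setminus\mathrm{dom}(\mathsf{r}))$,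 $p$ the highest priority in $\mathcal{G}'$, $\alpha=p\bmod 2$; compute $(Z,\sigma)=\mathit{TAttr}^{\mathcal{G}',T'}_\alpha(\{v\in\mathcal{G}'\mid\mathsf{pr}(v)=p\})$ (the region of priority $p$); $A:=$\texttt{extract-tangles}$(Z,\sigma)$; if some $t\in A$ has $E_T(t)=\emptyset$, return $(T\cup Y,t)$; otherwise set $\mathsf{r}(v):=p$ for all $v\in Z$ and $Y:=Y\cup A$. After the while loop, set $T:=T\cup Y$. -}

module Defs where

open import Data.Nat using (ℕ; zero; suc; _≤_; _⊔_; _≡ᵇ_)
open import Data.Bool using (Bool; true; false; not; _∧_; if_then_else_)
open import Data.Fin using (Fin)
import Data.Fin as F
open import Data.Fin.Subset using (Subset; _∈_; _∉_; _⊆_; _∪_; ⁅_⁆; ⊤; ⊥; ∁)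
open import Data.Vec using (tabulate; lookup)
open import Data.Maybe using (Maybe; just; nothing)
open import Data.List using (List; []; _++_; map)
open import Data.List.Membership.Propositional using () renaming (_∈_ to _∈ₗ_)
open import Data.Product using (Σ; ∃; _×_; _,_)
open import Data.Sum using (_⊎_)
open import Relation.Nullary using (¬_; does)
open import Relation.Binary.PropositionalEquality using (_≡_)
open import Relation.Binary.Construct.Closure.ReflexiveTransitive using (Star)

data Player : Set where
  even odd : Player

opp : Player → Player
opp even = odd
opp odd  = even

parity : ℕ → Player
parity zero          = even
parity (suc zero)    = odd
parity (suc (suc p)) = parity p

record Game (n : ℕ) : Set where
  field
    owner : Fin n → Player            -- V₀ = owner⁻¹ even, V₁ = owner⁻¹ odd
    E     : Fin n → Fin n → Bool      -- edge relation (finite, hence decidable)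
    pr    : Fin n → ℕ
    total : ∀ v → ∃ λ w → E v w ≡ true

module _ {n : ℕ} (G : Game n) where
  open Game G

  Edge : Fin n → Fin n → Set
  Edge u w = E u w ≡ true

  Strat : Set
  Strat = Fin n → Maybe (Fin n)

  record Play : Set where
    field
      π     : ℕ → Fin n
      valid : ∀ i → Edge (π i) (π (suc i))

  IsStrategy : Player → Strat → Set
  IsStrategy α σ = ∀ v w → σ v ≡ just w → owner v ≡ α × Edge v w

  Consistent : Strat → Play → Set
  Consistent σ ρ = ∀ i w → σ (Play.π ρ i) ≡ just w → Play.π ρ (suc i) ≡ w

  InfOften : Play → ℕ → Set
  InfOften ρ p = ∀ i → ∃ λ j → i ≤ j × pr (Play.π ρ j) ≡ p

  EventuallyLe : Play → ℕ → Set
  EventuallyLe ρ p = ∃ λ i → ∀ j → i ≤ j → pr (Play.π ρ j) ≤ p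

  -- the highest priority seen infinitely often has parity α
  Won : Player → Play → Set
  Won α ρ = ∀ p → InfOften ρ p → EventuallyLe ρ p → parity p ≡ α

  IsDominion : Player → Subset n → Set
  IsDominion α D = Σ Strat λ σ → IsStrategy α σ ×
    (∀ (ρ : Play) → Consistent σ ρ → Play.π ρ 0 ∈ D →
       (∀ i → Play.π ρ i ∈ D) × Won α ρ)

  IsMaxPr : Subset n → ℕ → Set
  IsMaxPr U p = (∃ λ u → u ∈ U × pr u ≡ p) × (∀ u → u ∈ U → pr u ≤ p)

  -- edges of the tangle graph  E ∩ (σ ∪ ((U ∩ V_ᾱ) × U))  restricted to U
  TEdge : Subset n → Player → Strat → Fin n → Fin n → Set
  TEdge U α σ u w = u ∈ U × w ∈ U × Edge u w ×
    ((owner u ≡ α × σ u ≡ just w) ⊎ owner u ≡ opp α)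

  -- nonempty paths u → w in a graph R, together with the highest priority
  -- of the vertices on the path
  data PathMax (R : Fin n → Fin n → Set) : Fin n → Fin n → ℕ → Set where
    edge : ∀ {u w} → R u w → PathMax R u w (pr u ⊔ pr w)
    cons : ∀ {u v w m} → R u v → PathMax R v w m → PathMax R u w (pr u ⊔ m)

  -- candidate tangles: a vertex set with a (witness) strategy
  record TC : Set where
    constructor tc
    field
      tset   : Subset n
      tstrat : Strat
  open TC public

  record IsTangle (t : TC) : Set where
    field
      top      : ℕ
      maxPr    : IsMaxPr (tset t) top
      stratDom : ∀ u → u ∈ tset t → owner u ≡ parity top →
                   ∃ λ w → tstrat t u ≡ just w
      stratCod : ∀ u w → tstrat t u ≡ just w →
                   u ∈ tset t × owner u ≡ parity top × w ∈ tset t × Edge u w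
      strong   : ∀ u w → u ∈ tset t → w ∈ tset t →
                   Star (TEdge (tset t) (parity top) (tstrat t)) u w
      cycles   : ∀ u m → PathMax (TEdge (tset t) (parity top) (tstrat t)) u u m →
                   parity m ≡ parity top

  ET : Subset n → Player → TC → Fin n → Set
  ET W α t v = v ∈ W × v ∉ tset t ×
    ∃ λ u → u ∈ tset t × owner u ≡ opp α × Edge u v

  upd : Strat → Fin n → Fin n → Strat
  upd σ v w u = if does (u F.≟ v) then just w else σ u

  extend : Strat → Strat → Strat
  extend σ τ u with σ u
  ... | just w  = just w
  ... | nothing = τ u

  restrict : Strat → Subset n → Strat
  restrict σ C u = if lookup C u then σ u else nothing

  σ∅ : Strat
  σ∅ _ = nothing

  -- Tangle attractor TAttr^{G ∩ W, T ∩ W}_α (A), as a small-step relation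
  -- on pairs (Z , σ); a run starts at (A , σ∅) and ends in a state with no step.

  data AttrStep (W : Subset n) (T : List TC) (α : Player) (A : Subset n)
       : Subset n × Strat → Subset n × Strat → Set where
    stepα : ∀ {Z σ v w} → v ∈ W → v ∉ Z → owner v ≡ α →
            w ∈ W → w ∈ Z → Edge v w →
            AttrStep W T α A (Z , σ) (Z ∪ ⁅ v ⁆ , upd σ v w)
    stepᾱ : ∀ {Z σ v} → v ∈ W → v ∉ Z → owner v ≡ opp α →
            (∀ w → w ∈ W → Edge v w → w ∈ Z) →
            AttrStep W T α A (Z , σ) (Z ∪ ⁅ v ⁆ , σ)
    stepA : ∀ {Z σ v w} → v ∈ A → owner v ≡ α → σ v ≡ nothing →
            w ∈ W → w ∈ Z → Edge v w →
            AttrStep W T α A (Z , σ) (Z , upd σ v w)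
    stepT : ∀ {Z σ} (t : TC) → t ∈ₗ T → tset t ⊆ W →
            (∃ λ p → IsMaxPr (tset t) p × parity p ≡ α) →
            (∃ λ v → ET W α t v) → (∀ v → ET W α t v → v ∈ Z) →
            (∃ λ u → u ∈ tset t × u ∉ Z) →
            AttrStep W T α A (Z , σ) (Z ∪ tset t , extend σ (tstrat t))

  AttrDone : Subset n → List TC → Player → Subset n → Subset n × Strat → Set
  AttrDone W T α A s = ∀ s' → ¬ AttrStep W T α A s s'

  PostFix : Subset n → Player → Subset n → Strat → Subset n → Set
  PostFix W α Z σ X = ∀ v → v ∈ X → v ∈ Z ×
    ((owner v ≡ opp α × (∀ w → w ∈ W → Edge v w → w ∈ X)) ⊎
     (owner v ≡ α × ∃ λ w → σ v ≡ just w × w ∈ X))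

  PreFix : Subset n → Player → Subset n → Strat → Subset n → Set
  PreFix W α Z σ X = ∀ v → v ∈ Z →
    ((owner v ≡ opp α × (∀ w → w ∈ W → Edge v w → w ∈ X)) ⊎
     (owner v ≡ α × ∃ λ w → σ v ≡ just w × w ∈ X)) → v ∈ X

  IsGFP : Subset n → Player → Subset n → Strat → Subset n → Set
  IsGFP W α Z σ X = PostFix W α Z σ X × PreFix W α Z σ X ×
    (∀ X' → PostFix W α Z σ X' → X' ⊆ X)

  HEdge : Subset n → Player → Strat → Subset n → Fin n → Fin n → Set
  HEdge W α σ X u w = u ∈ X × w ∈ X ×
    ((owner u ≡ opp α × w ∈ W × Edge u w) ⊎ (owner u ≡ α × σ u ≡ just w))

  NBSCC : Subset n → Player → Strat → Subset n → Subset n → Set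
  NBSCC W α σ X C = C ⊆ X ×
    (∃ λ u → ∃ λ w → u ∈ C × w ∈ C × HEdge W α σ X u w) ×
    (∀ u w → u ∈ C → w ∈ C → Star (HEdge W α σ X) u w) ×
    (∀ u w → u ∈ C → HEdge W α σ X u w → w ∈ C)

  Extract : Subset n → Player → Subset n → Strat → List (Subset n) → Set
  Extract W α Z σ L = ∃ λ X → IsGFP W α Z σ X ×
    (∀ C → C ∈ₗ L → NBSCC W α σ X C) × (∀ C → NBSCC W α σ X C → C ∈ₗ L)

  mkTangles : Strat → List (Subset n) → List TC
  mkTangles σ L = map (λ C → tc C (restrict σ C)) L

  topSet : Subset n → ℕ → Subset n
  topSet R p = tabulate (λ v → not (lookup R v) ∧ (pr v ≡ᵇ p))

  -- R = dom(r)
  data SState : Set where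
    loop : (T : List TC) (R : Subset n) (Y : List TC) → SState
    attr : (T : List TC) (R : Subset n) (Y : List TC) (p : ℕ)
           (Z : Subset n) (σ : Strat) → SState
    done : (T'' : List TC) (t : TC) → SState

  data SStep : SState → SState → Set where
    restart : ∀ {T R Y} → (∀ v → v ∈ R) →
              SStep (loop T R Y) (loop (T ++ Y) ⊥ [])
    begin   : ∀ {T R Y p} → (∃ λ v → v ∉ R) → IsMaxPr (∁ R) p →
              SStep (loop T R Y) (attr T R Y p (topSet R p) σ∅)
    attrStep : ∀ {T R Y p Z σ Z' σ'} →
              AttrStep (∁ R) T (parity p) (topSet R p) (Z , σ) (Z' , σ') →
              SStep (attr T R Y p Z σ) (attr T R Y p Z' σ')
    return  : ∀ {T R Y p Z σ L} (t : TC) →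
              AttrDone (∁ R) T (parity p) (topSet R p) (Z , σ) →
              Extract (∁ R) (parity p) Z σ L →
              t ∈ₗ mkTangles σ L → (∀ v → ¬ ET ⊤ (parity p) t v) →
              SStep (attr T R Y p Z σ) (done (T ++ Y) t)
    continue : ∀ {T R Y p Z σ L} →
              AttrDone (∁ R) T (parity p) (topSet R p) (Z , σ) →
              Extract (∁ R) (parity p) Z σ L →
              (∀ t → t ∈ₗ mkTangles σ L → ∃ λ v → ET ⊤ (parity p) t v) →
              SStep (attr T R Y p Z σ) (loop T (R ∪ Z) (Y ++ mkTangles σ L))

  initial : List TC → SState
  initial T = loop T ⊥ []

-- While the tangle attractor of the top priority p of the current subgame runs, every cycle of the
-- graph made of its strategy on α-vertices and of all subgame edges on the other vertices is won
-- by α: a cycle through a vertex of priority p has top priority p, any other cycle lies in the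
-- earlier attractor or inside an attracted tangle. So every bottom SCC extracted from the attractor
-- is a tangle without escapes in the subgame, and a returned one, which has no escapes at all, is a
-- dominion: a play consistent with its strategy stays in it, and the highest priority seen
-- infinitely often closes a cycle of the tangle.
--
-- Termination is lexicographic: an attractor step adds vertices or fixes a strategy choice, each
-- region removes vertices from the subgame, and a pass of the while loop that does not return adds
-- a tangle whose vertex set is new to T. Indeed, the last region of the pass covers its whole
-- subgame, so its bottom SCCs escape only into earlier regions, and a tangle of T doing so would
-- also escape within the subgame.

module Submission where

open import Defs
open import Data.Nat using (ℕ; zero; suc; _≤_; _<_; _⊔_; _∸_; _+_; _≡ᵇ_; z≤n; s≤s)
import Data.Nat.Properties as ℕ
open import Data.Bool using (true; false; not; _∧_; T)
import Data.Bool.Properties as Bool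
open import Data.Maybe using (Maybe; just; nothing)
import Data.Maybe.Properties as Maybe
open import Data.Fin using (Fin; zero; suc; toℕ)
import Data.Fin.Properties as Fin
open import Data.Fin.Subset using (Subset; _∈_; _∉_; _⊆_; _⊂_; _∪_; ⁅_⁆; ⊤; ⊥; ∁; ∣_∣; inside; outside)
open import Data.Fin.Subset.Properties
  using (_∈?_; _⊆?_; nonempty?; x∈p∪q⁻; p⊆p∪q; q⊆p∪q; x∈⁅x⁆; x∈⁅y⁆⇒x≡y; p⊂q⇒∣p∣<∣q∣; ∣p∣≤n;
         ∈⊤; ∉⊥; x∉p⇒x∈∁p; x∈∁p⇒x∉p)
open import Data.Vec using (tabulate; lookup; []; _∷_)
import Data.Vec.Properties as Vec
open import Data.List using (List; []; _∷_; _++_; map; filter; length; allFin)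
open import Data.List.Membership.Propositional using (find; lose) renaming (_∈_ to _∈ₗ_)
open import Data.List.Membership.Propositional.Properties
  using (∈-allFin; ∈-map⁺; ∈-map⁻; ∈-++⁺ˡ; ∈-++⁺ʳ; ∈-filter⁺; ∈-filter⁻)
open import Data.List.Relation.Unary.Any using (here; there)
import Data.List.Relation.Unary.Any as Any
import Data.List.Relation.Unary.Any.Properties as Any
open import Data.List.Relation.Unary.All using (All; []; _∷_)
import Data.List.Relation.Unary.All as All
import Data.List.Relation.Unary.All.Properties as All
import Data.List.Extrema ℕ.≤-totalOrder as Extrema
open import Data.Product using (∃; ∃₂; _×_; _,_; proj₁; proj₂)
open import Data.Sum using (_⊎_; inj₁; inj₂)
open import Data.Empty using () renaming (⊥ to Empty; ⊥-elim to absurd)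
open import Function using (_∘_; Equivalence)
open import Relation.Nullary using (¬_; Dec; yes; no; does; ¬?; _×-dec_; _⊎-dec_; _→-dec_)
open import Relation.Nullary.Decidable using (dec-true)
open import Level using (0ℓ)
open import Relation.Unary using (Pred; Decidable)
open import Relation.Binary using (Rel; DecidableEquality)
open import Relation.Binary.Construct.Never using (Never)
open import Relation.Binary.PropositionalEquality using (_≡_; _≢_; refl; sym; trans; cong; subst)
open import Relation.Binary.Construct.Closure.ReflexiveTransitive using (Star; ε; _◅_; _◅◅_) renaming (map to Star-map)
open import Induction.WellFounded using (Acc; acc)
open import Data.Nat.Induction using (<-wellFounded)

opp-≢ : ∀ α → α ≢ opp α
opp-≢ even ()
opp-≢ odd ()

_≟ₚ_ : DecidableEquality Player
even ≟ₚ even = yes refl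
even ≟ₚ odd  = no λ ()
odd  ≟ₚ even = no λ ()
odd  ≟ₚ odd  = yes refl

player-cases : ∀ α β → β ≡ α ⊎ β ≡ opp α
player-cases even even = inj₁ refl
player-cases even odd  = inj₂ refl
player-cases odd  even = inj₂ refl
player-cases odd  odd  = inj₁ refl

opaque
  iterate-until-stuck : {S : Set} (f : S → S) (μ : S → ℕ) {Inv Progress : S → Set} →
    Decidable Progress → (∀ s → Progress s → μ (f s) < μ s) → (∀ s → Inv s → Inv (f s)) →
    ∀ s → Inv s → ∃ λ s' → Inv s' × ¬ Progress s'
  iterate-until-stuck {S} f μ {Inv} {Progress} progress? decreases preserves s inv =
    go s (<-wellFounded (μ s)) inv
    where
    go : ∀ s → Acc _<_ (μ s) → Inv s → ∃ λ s' → Inv s' × ¬ Progress s'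
    go s (acc rec) inv with progress? s
    ... | no stuck = s , inv , stuck
    ... | yes prog = go (f s) (rec (decreases s prog)) (preserves s inv)

module _ {A : Set} {P Q : Pred A 0ℓ} (P? : Decidable P) (Q? : Decidable Q) (P⇒Q : ∀ x → P x → Q x) where

  length-filter-¬-antimono : ∀ xs → length (filter (¬? ∘ Q?) xs) ≤ length (filter (¬? ∘ P?) xs)
  length-filter-¬-antimono [] = z≤n
  length-filter-¬-antimono (x ∷ xs) with Q? x | P? x
  ... | yes _ | yes _  = length-filter-¬-antimono xs
  ... | yes _ | no _   = ℕ.m≤n⇒m≤1+n (length-filter-¬-antimono xs)
  ... | no ¬q | yes p  = absurd (¬q (P⇒Q x p))
  ... | no _  | no _   = s≤s (length-filter-¬-antimono xs)

  length-filter-¬-strict : ∀ xs {y} → y ∈ₗ xs → ¬ P y → Q y →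
    length (filter (¬? ∘ Q?) xs) < length (filter (¬? ∘ P?) xs)
  length-filter-¬-strict (x ∷ xs) (here refl) ¬py qy with Q? x | P? x
  ... | yes _ | yes py = absurd (¬py py)
  ... | yes _ | no _   = s≤s (length-filter-¬-antimono xs)
  ... | no ¬q | _      = absurd (¬q qy)
  length-filter-¬-strict (x ∷ xs) (there y∈) ¬py qy with Q? x | P? x
  ... | yes _ | yes _  = length-filter-¬-strict xs y∈ ¬py qy
  ... | yes _ | no _   = ℕ.m≤n⇒m≤1+n (length-filter-¬-strict xs y∈ ¬py qy)
  ... | no ¬q | yes p  = absurd (¬q (P⇒Q x p))
  ... | no _  | no _   = s≤s (length-filter-¬-strict xs y∈ ¬py qy)

subsets : ∀ k → List (Subset k)
subsets zero    = [] ∷ []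
subsets (suc k) = map (inside ∷_) (subsets k) ++ map (outside ∷_) (subsets k)

∈-subsets : ∀ {k} (S : Subset k) → S ∈ₗ subsets k
∈-subsets [] = here refl
∈-subsets (inside ∷ S) = ∈-++⁺ˡ (∈-map⁺ (inside ∷_) (∈-subsets S))
∈-subsets {suc k} (outside ∷ S) =
  ∈-++⁺ʳ (map (inside ∷_) (subsets k)) (∈-map⁺ (outside ∷_) (∈-subsets S))

module _ {m : ℕ} where

  select : {P : Pred (Fin m) 0ℓ} → Decidable P → Subset m
  select P? = tabulate (does ∘ P?)

  ∈-select⁺ : ∀ {P : Pred (Fin m) 0ℓ} (P? : Decidable P) {v} → P v → v ∈ select P?
  ∈-select⁺ P? {v} pv = Vec.lookup⇒[]= v _ (trans (Vec.lookup∘tabulate (does ∘ P?) v) (dec-true (P? v) pv))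

  ∈-select⁻ : ∀ {P : Pred (Fin m) 0ℓ} (P? : Decidable P) {v} → v ∈ select P? → P v
  ∈-select⁻ P? {v} v∈ with P? v | trans (sym (Vec.lookup∘tabulate (does ∘ P?) v)) (Vec.[]=⇒lookup v∈)
  ... | yes pv | _ = pv
  ... | no _   | ()

  p⊂q⇒m∸∣q∣<m∸∣p∣ : ∀ {p q : Subset m} → p ⊂ q → m ∸ ∣ q ∣ < m ∸ ∣ p ∣
  p⊂q⇒m∸∣q∣<m∸∣p∣ {q = q} p⊂q = ℕ.∸-monoʳ-< (p⊂q⇒∣p∣<∣q∣ p⊂q) (∣p∣≤n q)

  x∈p∪⁅y⁆⁻ : ∀ {p : Subset m} {x y} → x ∈ p ∪ ⁅ y ⁆ → x ∈ p ⊎ x ≡ y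
  x∈p∪⁅y⁆⁻ {p} {y = y} x∈ with x∈p∪q⁻ p ⁅ y ⁆ x∈
  ... | inj₁ x∈p = inj₁ x∈p
  ... | inj₂ x∈y = inj₂ (x∈⁅y⁆⇒x≡y y x∈y)

  opaque
    argmin : ∀ {P : Pred (Fin m) 0ℓ} (f : Fin m → ℕ) → Decidable P → ∃ P →
             ∃ λ u → P u × ∀ w → P w → f u ≤ f w
    argmin f P? (v , pv) =
      Extrema.argmin f v xs ,
      Extrema.argmin-all f pv (All.tabulate (proj₂ ∘ ∈-filter⁻ P? {xs = allFin m})) ,
      λ w pw → All.lookup (Extrema.f[argmin]≤f[xs] v xs) (∈-filter⁺ P? (∈-allFin w) pw)
      where
      xs : List (Fin m)
      xs = filter P? (allFin m)

  opaque
    argmax : ∀ {P : Pred (Fin m) 0ℓ} (f : Fin m → ℕ) → Decidable P → ∃ P →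
             ∃ λ u → P u × ∀ w → P w → f w ≤ f u
    argmax f P? (v , pv) =
      Extrema.argmax f v xs ,
      Extrema.argmax-all f pv (All.tabulate (proj₂ ∘ ∈-filter⁻ P? {xs = allFin m})) ,
      λ w pw → All.lookup (Extrema.f[xs]≤f[argmax] v xs) (∈-filter⁺ P? (∈-allFin w) pw)
      where
      xs : List (Fin m)
      xs = filter P? (allFin m)

module _ {m : ℕ} (R : Fin m → Fin m → Set) where

  Closed : Subset m → Set
  Closed S = ∀ v w → v ∈ S → R v w → w ∈ S

  closed-star : ∀ {S} → Closed S → ∀ {v w} → v ∈ S → Star R v w → w ∈ S
  closed-star cl v∈ ε = v∈
  closed-star cl v∈ (e ◅ path) = closed-star cl (cl _ _ v∈ e) path

module Reachability {m : ℕ} {R : Fin m → Fin m → Set} (R? : ∀ u w → Dec (R u w)) where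

  private
    Leaves : Subset m → Set
    Leaves S = ∃₂ λ v w → v ∈ S × R v w × w ∉ S

    leaves? : Decidable Leaves
    leaves? S = Fin.any? λ v → Fin.any? λ w → v ∈? S ×-dec R? v w ×-dec ¬? (w ∈? S)

    successor? : ∀ S → Decidable (λ w → ∃ λ v → v ∈ S × R v w)
    successor? S w = Fin.any? λ v → v ∈? S ×-dec R? v w

    successors : Subset m → Subset m
    successors S = select (successor? S)

    ¬leaves⇒closed : ∀ S → ¬ Leaves S → Closed R S
    ¬leaves⇒closed S stuck v w v∈ e with w ∈? S
    ... | yes w∈ = w∈
    ... | no w∉ = absurd (stuck (v , w , v∈ , e , w∉))

  module _ (u : Fin m) where
    private
      grow : Subset m → Subset m
      grow S = S ∪ successors S

      grows : ∀ S → Leaves S → m ∸ ∣ grow S ∣ < m ∸ ∣ S ∣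
      grows S (v , w , v∈ , e , w∉) =
        p⊂q⇒m∸∣q∣<m∸∣p∣ (p⊆p∪q _ , w , q⊆p∪q S _ (∈-select⁺ (successor? S) (v , v∈ , e)) , w∉)

      Reached : Subset m → Set
      Reached S = u ∈ S × ∀ w → w ∈ S → Star R u w

      reached-grow : ∀ S → Reached S → Reached (grow S)
      reached-grow S (u∈ , reached) = p⊆p∪q _ u∈ , λ w w∈ → step w (x∈p∪q⁻ S _ w∈)
        where
        step : ∀ w → w ∈ S ⊎ w ∈ successors S → Star R u w
        step w (inj₁ w∈) = reached w w∈
        step w (inj₂ w∈) with ∈-select⁻ (successor? S) w∈
        ... | v , v∈ , e = reached v v∈ ◅◅ (e ◅ ε)

      reached-⁅u⁆ : Reached ⁅ u ⁆
      reached-⁅u⁆ = x∈⁅x⁆ u , λ w w∈ → subst (Star R u) (sym (x∈⁅y⁆⇒x≡y u w∈)) ε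

    opaque
      reachable : ∃ λ S → u ∈ S × (∀ w → w ∈ S → Star R u w) × Closed R S
      reachable with iterate-until-stuck grow (λ S → m ∸ ∣ S ∣) leaves? grows reached-grow ⁅ u ⁆ reached-⁅u⁆
      ... | S , (u∈ , reached) , stuck = S , u∈ , reached , ¬leaves⇒closed S stuck

  -- The vertex u whose reachable set is smallest can be reached back from every vertex it reaches.
  bottom-component : {X : Subset m} → (∀ {u w} → R u w → u ∈ X × w ∈ X) → (∀ u → u ∈ X → ∃ λ w → R u w) →
    (∃ λ u → u ∈ X) → ∃ λ C → C ⊆ X × (∃₂ λ u w → u ∈ C × w ∈ C × R u w) ×
                               (∀ u w → u ∈ C → w ∈ C → Star R u w) × Closed R C
  bottom-component {X} R⊆X serial nonempty =
    C , C⊆X , (u , w , u∈C , closed u w u∈C e , e) , (λ x y x∈ y∈ → back x x∈ ◅◅ reaches y y∈) , closed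
    where
    Reach : Fin m → Subset m
    Reach v = proj₁ (reachable v)

    minimal : ∃ λ u → u ∈ X × ∀ w → w ∈ X → ∣ Reach u ∣ ≤ ∣ Reach w ∣
    minimal = argmin (λ v → ∣ Reach v ∣) (_∈? X) nonempty

    u : Fin m
    u = proj₁ minimal

    C : Subset m
    C = Reach u

    u∈C : u ∈ C
    u∈C = proj₁ (proj₂ (reachable u))

    reaches : ∀ {v} → ∀ w → w ∈ Reach v → Star R v w
    reaches {v} = proj₁ (proj₂ (proj₂ (reachable v)))

    closed : Closed R C
    closed = proj₂ (proj₂ (proj₂ (reachable u)))

    C⊆X : C ⊆ X
    C⊆X w∈ = closed-star R (λ _ _ _ e → proj₂ (R⊆X e)) (proj₁ (proj₂ minimal)) (reaches _ w∈)

    out-edge : ∃ λ w → R u w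
    out-edge = serial u (proj₁ (proj₂ minimal))

    w : Fin m
    w = proj₁ out-edge

    e : R u w
    e = proj₂ out-edge

    back : ∀ x → x ∈ C → Star R x u
    back x x∈ with u ∈? Reach x
    ... | yes u∈ = reaches u u∈
    ... | no u∉ = absurd (ℕ.<⇒≱ (p⊂q⇒∣p∣<∣q∣ (Reach[x]⊆C , u , u∈C , u∉)) (proj₂ (proj₂ minimal) x (C⊆X x∈)))
      where
      Reach[x]⊆C : Reach x ⊆ C
      Reach[x]⊆C z∈ = closed-star R closed u∈C (reaches x x∈ ◅◅ reaches _ z∈)

  star? : ∀ u w → Dec (Star R u w)
  star? u w with reachable u
  ... | S , u∈ , reached , closed with w ∈? S
  ...   | yes w∈ = yes (reached w w∈)
  ...   | no w∉ = no λ path → w∉ (closed-star R closed u∈ path)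

module Search {m : ℕ} (G : Game m) where
  open Game G

  edge? : ∀ u w → Dec (Edge G u w)
  edge? u w = E u w Bool.≟ true

  chooses? : ∀ (σ : Strat G) u w → Dec (σ u ≡ just w)
  chooses? σ u w = Maybe.≡-dec Fin._≟_ (σ u) (just w)

  undefined? : ∀ (σ : Strat G) u → Dec (σ u ≡ nothing)
  undefined? σ u = Maybe.≡-dec Fin._≟_ (σ u) nothing

  ownership : ∀ α u → owner u ≡ α ⊎ owner u ≡ opp α
  ownership α u = player-cases α (owner u)

  owned-by-both : ∀ {α u} → owner u ≡ α → owner u ≡ opp α → Empty
  owned-by-both {α} u-α u-ᾱ = opp-≢ α (trans (sym u-α) u-ᾱ)

  ∈-topSet⁻ : ∀ {R p v} → v ∈ topSet G R p → v ∉ R × pr v ≡ p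
  ∈-topSet⁻ {R} {p} {v} v∈ with lookup R v in R[v] | pr v ≡ᵇ p in pr≡ᵇp
     | trans (sym (Vec.lookup∘tabulate (λ v → not (lookup R v) ∧ (pr v ≡ᵇ p)) v)) (Vec.[]=⇒lookup v∈)
  ... | false | true | _ = (λ v∈R → true≢false (trans (sym (Vec.[]=⇒lookup v∈R)) R[v])) ,
                          ℕ.≡ᵇ⇒≡ (pr v) p (subst T (sym pr≡ᵇp) _)
    where
    true≢false : true ≢ false
    true≢false ()
  ... | true  | _     | ()
  ... | false | false | ()

  ∈-topSet⁺ : ∀ {R p v} → v ∉ R → pr v ≡ p → v ∈ topSet G R p
  ∈-topSet⁺ {R} {p} {v} v∉ refl =
    Vec.lookup⇒[]= v _ (trans (Vec.lookup∘tabulate (λ w → not (lookup R w) ∧ (pr w ≡ᵇ pr v)) v) top)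
    where
    top : not (lookup R v) ∧ (pr v ≡ᵇ pr v) ≡ true
    top with lookup R v in R[v]
    ... | true  = absurd (v∉ (Vec.lookup⇒[]= v R R[v]))
    ... | false = Equivalence.to Bool.T-≡ (ℕ.≡⇒≡ᵇ (pr v) (pr v) refl)

  IsMaxPr-unique : ∀ {U p q} → IsMaxPr G U p → IsMaxPr G U q → p ≡ q
  IsMaxPr-unique ((u , u∈ , refl) , p-max) ((w , w∈ , refl) , q-max) =
    ℕ.≤-antisym (q-max u u∈) (p-max w w∈)

  max-pr? : (U : Subset m) → (∃ λ p → IsMaxPr G U p) ⊎ (∀ u → u ∉ U)
  max-pr? U with nonempty? U
  ... | no empty = inj₂ λ u u∈ → empty (u , u∈)
  ... | yes nonempty with argmax pr (_∈? U) nonempty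
  ...   | u , u∈ , max = inj₁ (pr u , (u , u∈ , refl) , max)

  max-pr-parity? : ∀ U α → Dec (∃ λ p → IsMaxPr G U p × parity p ≡ α)
  max-pr-parity? U α with max-pr? U
  ... | inj₂ empty = no λ { (_ , ((u , u∈ , _) , _) , _) → empty u u∈ }
  ... | inj₁ (p , max) with parity p ≟ₚ α
  ...   | yes p-α = yes (p , max , p-α)
  ...   | no ¬p-α = no λ { (q , max' , q-α) → ¬p-α (trans (cong parity (IsMaxPr-unique max max')) q-α) }

  upd-≡ : ∀ σ v w → upd G σ v w v ≡ just w
  upd-≡ σ v w with v Fin.≟ v
  ... | yes _  = refl
  ... | no v≢v = absurd (v≢v refl)

  upd-≢ : ∀ σ v w {u} → u ≢ v → upd G σ v w u ≡ σ u
  upd-≢ σ v w {u} u≢v with u Fin.≟ v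
  ... | yes u≡v = absurd (u≢v u≡v)
  ... | no _    = refl

  upd-just⁻ : ∀ σ v w {u x} → upd G σ v w u ≡ just x → (u ≡ v × x ≡ w) ⊎ (u ≢ v × σ u ≡ just x)
  upd-just⁻ σ v w {u} σ'u with u Fin.≟ v
  ... | yes u≡v = inj₁ (u≡v , sym (Maybe.just-injective σ'u))
  ... | no u≢v  = inj₂ (u≢v , σ'u)

  extend-just⁻ : ∀ σ τ {u x} → extend G σ τ u ≡ just x → σ u ≡ just x ⊎ (σ u ≡ nothing × τ u ≡ just x)
  extend-just⁻ σ τ {u} σ'u with σ u
  ... | just _  = inj₁ σ'u
  ... | nothing = inj₂ (refl , σ'u)

  restrict-∈ : ∀ σ C {u} → u ∈ C → restrict G σ C u ≡ σ u
  restrict-∈ σ C u∈ rewrite Vec.[]=⇒lookup u∈ = refl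

  restrict-just⁻ : ∀ σ C {u x} → restrict G σ C u ≡ just x → u ∈ C × σ u ≡ just x
  restrict-just⁻ σ C {u} σ'u with lookup C u in C[u]
  ... | true = Vec.lookup⇒[]= u C C[u] , σ'u

  AllCyclesWon : Player → Rel (Fin m) 0ℓ → Set
  AllCyclesWon α R = ∀ u k → PathMax G R u u k → parity k ≡ α

  never-cycles : ∀ {α} → AllCyclesWon α Never
  never-cycles u k (edge ())
  never-cycles u k (cons () _)

  PathMax-pr≤ : ∀ {R u w k} → PathMax G R u w k → pr u ≤ k
  PathMax-pr≤ (edge _)   = ℕ.m≤m⊔n _ _
  PathMax-pr≤ (cons _ _) = ℕ.m≤m⊔n _ _

  PathMax-≤ : ∀ {R B} → (∀ {u w} → R u w → pr u ≤ B × pr w ≤ B) → ∀ {u w k} → PathMax G R u w k → k ≤ B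
  PathMax-≤ bounded (edge e)      = ℕ.⊔-lub (proj₁ (bounded e)) (proj₂ (bounded e))
  PathMax-≤ bounded (cons e path) = ℕ.⊔-lub (proj₁ (bounded e)) (PathMax-≤ bounded path)

  PathMax-map : ∀ {R R'} → (∀ {u w} → R u w → R' u w) → ∀ {u w k} → PathMax G R u w k → PathMax G R' u w k
  PathMax-map f (edge e)      = edge (f e)
  PathMax-map f (cons e path) = cons (f e) (PathMax-map f path)

  PathMax-via : ∀ {R u a b w} → Star R u a → R a b → Star R b w → ∃ λ k → PathMax G R u w k
  PathMax-via ε e ε = _ , edge e
  PathMax-via ε e (e' ◅ path) = _ , cons e (proj₂ (PathMax-via ε e' path))
  PathMax-via (e' ◅ path) e path' = _ , cons e' (proj₂ (PathMax-via path e path'))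

  AttrEdge : Subset m → Player → Strat G → Subset m → Rel (Fin m) 0ℓ
  AttrEdge W α σ Z u w = u ∈ Z × w ∈ Z ×
    ((owner u ≡ α × σ u ≡ just w) ⊎ (owner u ≡ opp α × w ∈ W × Edge G u w))

  -- A cycle through A has the top priority p. Otherwise each of its edges starting in Z is an Old
  -- edge staying in Z, and each edge starting outside Z enters Z for good or is an Added edge.
  module _ {W A Z : Subset m} {α : Player} {p : ℕ} {New Old Added : Rel (Fin m) 0ℓ}
    (pr≤p : ∀ v → v ∈ W → pr v ≤ p) (pr-A : ∀ v → v ∈ A → pr v ≡ p) (parity-p : parity p ≡ α)
    (New⊆W : ∀ {u w} → New u w → u ∈ W × w ∈ W)
    (classify : ∀ {u w} → New u w →
       u ∈ A ⊎ (u ∈ Z × w ∈ Z × Old u w) ⊎ (u ∉ Z × (w ∈ Z ⊎ (w ∉ Z × Added u w))))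
    where

    private
      from-A : ∀ {u w k} → u ∈ A → PathMax G New u w k → p ≤ k
      from-A {u} u∈A path = subst (_≤ _) (pr-A u u∈A) (PathMax-pr≤ path)

      path-cases : ∀ {u w k} → PathMax G New u w k →
        p ≤ k ⊎ ((u ∈ Z → w ∈ Z × PathMax G Old u w k) × (u ∉ Z → w ∉ Z → PathMax G Added u w k))
      path-cases path@(edge e) with classify e
      ... | inj₁ u∈A = inj₁ (from-A u∈A path)
      ... | inj₂ (inj₁ (u∈Z , w∈Z , old)) = inj₂ ((λ _ → w∈Z , edge old) , λ u∉Z _ → absurd (u∉Z u∈Z))
      ... | inj₂ (inj₂ (u∉Z , inj₁ w∈Z)) = inj₂ ((λ u∈Z → absurd (u∉Z u∈Z)) , λ _ w∉Z → absurd (w∉Z w∈Z))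
      ... | inj₂ (inj₂ (u∉Z , inj₂ (_ , added))) = inj₂ ((λ u∈Z → absurd (u∉Z u∈Z)) , λ _ _ → edge added)
      path-cases path@(cons e rest) with path-cases rest
      ... | inj₁ p≤k = inj₁ (ℕ.≤-trans p≤k (ℕ.m≤n⊔m _ _))
      ... | inj₂ (inZ , outZ) with classify e
      ...   | inj₁ u∈A = inj₁ (from-A u∈A path)
      ...   | inj₂ (inj₁ (u∈Z , v∈Z , old)) =
                inj₂ ((λ _ → proj₁ (inZ v∈Z) , cons old (proj₂ (inZ v∈Z))) , λ u∉Z _ → absurd (u∉Z u∈Z))
      ...   | inj₂ (inj₂ (u∉Z , inj₁ v∈Z)) =
                inj₂ ((λ u∈Z → absurd (u∉Z u∈Z)) , λ _ w∉Z → absurd (w∉Z (proj₁ (inZ v∈Z))))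
      ...   | inj₂ (inj₂ (u∉Z , inj₂ (v∉Z , added))) =
                inj₂ ((λ u∈Z → absurd (u∉Z u∈Z)) , λ _ w∉Z → cons added (outZ v∉Z w∉Z))

    cycles-split : AllCyclesWon α Old → AllCyclesWon α Added → AllCyclesWon α New
    cycles-split old-won added-won u k cycle with path-cases cycle
    ... | inj₁ p≤k = trans (cong parity (ℕ.≤-antisym k≤p p≤k)) parity-p
      where
      k≤p = PathMax-≤ (λ e → pr≤p _ (proj₁ (New⊆W e)) , pr≤p _ (proj₂ (New⊆W e))) cycle
    ... | inj₂ (inZ , outZ) with u ∈? Z
    ...   | yes u∈Z = old-won u k (proj₂ (inZ u∈Z))
    ...   | no u∉Z  = added-won u k (outZ u∉Z u∉Z)

  record AttractorInvariant (W A : Subset m) (α : Player) (p : ℕ) (Z : Subset m) (σ : Strat G) : Set where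
    field
      pr≤top   : ∀ v → v ∈ W → pr v ≤ p
      pr-A     : ∀ v → v ∈ A → pr v ≡ p
      parity-p : parity p ≡ α
      A⊆Z      : ∀ v → v ∈ A → v ∈ Z
      Z⊆W      : ∀ v → v ∈ Z → v ∈ W
      σ-sound  : ∀ u w → σ u ≡ just w → u ∈ Z × w ∈ Z × owner u ≡ α × Edge G u w
      σ-total  : ∀ u → u ∈ Z → u ∉ A → owner u ≡ α → ∃ λ w → σ u ≡ just w
      ᾱ-closed : ∀ u → u ∈ Z → u ∉ A → owner u ≡ opp α → ∀ w → w ∈ W → Edge G u w → w ∈ Z
      cycles   : AllCyclesWon α (AttrEdge W α σ Z)

  module AttractorSteps {W A : Subset m} {α : Player} {p : ℕ} {Z : Subset m} {σ : Strat G}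
                        (I : AttractorInvariant W A α p Z σ) where
    open AttractorInvariant I

    cycles-after : ∀ {Z' σ' Added} → (∀ x → x ∈ Z' → x ∈ W) →
      (∀ {u w} → AttrEdge W α σ' Z' u w →
         u ∈ A ⊎ (u ∈ Z × w ∈ Z × AttrEdge W α σ Z u w) ⊎ (u ∉ Z × (w ∈ Z ⊎ (w ∉ Z × Added u w)))) →
      AllCyclesWon α Added → AllCyclesWon α (AttrEdge W α σ' Z')
    cycles-after Z'⊆W classify =
      cycles-split pr≤top pr-A parity-p (λ (u∈ , w∈ , _) → Z'⊆W _ u∈ , Z'⊆W _ w∈) classify cycles

    old-edge : ∀ {Z' σ' u w} → u ∈ Z → u ∉ A → (σ' u ≡ just w → σ u ≡ just w) →
               AttrEdge W α σ' Z' u w → AttrEdge W α σ Z u w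
    old-edge u∈Z u∉A same (_ , _ , inj₁ (u-α , σ'u)) =
      u∈Z , proj₁ (proj₂ (σ-sound _ _ (same σ'u))) , inj₁ (u-α , same σ'u)
    old-edge u∈Z u∉A same (_ , _ , inj₂ (u-ᾱ , w∈W , e)) =
      u∈Z , ᾱ-closed _ u∈Z u∉A u-ᾱ _ w∈W e , inj₂ (u-ᾱ , w∈W , e)

    module _ {v : Fin m} (v∈W : v ∈ W) (v∉Z : v ∉ Z) where
      private
        Z' = Z ∪ ⁅ v ⁆

        Z'⊆W : ∀ x → x ∈ Z' → x ∈ W
        Z'⊆W x x∈ with x∈p∪⁅y⁆⁻ x∈
        ... | inj₁ x∈Z = Z⊆W x x∈Z
        ... | inj₂ refl = v∈W

        Z⊆Z' : ∀ {x} → x ∈ Z → x ∈ Z'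
        Z⊆Z' = p⊆p∪q _

        v∈Z' : v ∈ Z'
        v∈Z' = q⊆p∪q Z _ (x∈⁅x⁆ v)

        ≢v : ∀ {u} → u ∈ Z → u ≢ v
        ≢v u∈Z refl = v∉Z u∈Z

      α-step : ∀ {w} → owner v ≡ α → w ∈ W → w ∈ Z → Edge G v w →
               AttractorInvariant W A α p Z' (upd G σ v w)
      α-step {w} v-α w∈W w∈Z e = record
        { pr≤top = pr≤top ; pr-A = pr-A ; parity-p = parity-p
        ; A⊆Z = λ x x∈A → Z⊆Z' (A⊆Z x x∈A) ; Z⊆W = Z'⊆W
        ; σ-sound = σ'-sound ; σ-total = σ'-total ; ᾱ-closed = ᾱ-closed'
        ; cycles = cycles-after Z'⊆W classify never-cycles }
        where
        σ' = upd G σ v w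

        σ'-sound : ∀ u x → σ' u ≡ just x → u ∈ Z' × x ∈ Z' × owner u ≡ α × Edge G u x
        σ'-sound u x σ'u with upd-just⁻ σ v w σ'u
        ... | inj₁ (refl , refl) = v∈Z' , Z⊆Z' w∈Z , v-α , e
        ... | inj₂ (_ , σu) = let (u∈ , x∈ , u-α , e') = σ-sound u x σu in Z⊆Z' u∈ , Z⊆Z' x∈ , u-α , e'

        σ'-total : ∀ u → u ∈ Z' → u ∉ A → owner u ≡ α → ∃ λ x → σ' u ≡ just x
        σ'-total u u∈ u∉A u-α with x∈p∪⁅y⁆⁻ u∈
        ... | inj₂ refl = w , upd-≡ σ v w
        ... | inj₁ u∈Z  = let (x , σu) = σ-total u u∈Z u∉A u-α in x , trans (upd-≢ σ v w (≢v u∈Z)) σu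

        ᾱ-closed' : ∀ u → u ∈ Z' → u ∉ A → owner u ≡ opp α → ∀ x → x ∈ W → Edge G u x → x ∈ Z'
        ᾱ-closed' u u∈ u∉A u-ᾱ x x∈W e' with x∈p∪⁅y⁆⁻ u∈
        ... | inj₂ refl = absurd (owned-by-both v-α u-ᾱ)
        ... | inj₁ u∈Z  = Z⊆Z' (ᾱ-closed u u∈Z u∉A u-ᾱ x x∈W e')

        classify : ∀ {u x} → AttrEdge W α σ' Z' u x →
          u ∈ A ⊎ (u ∈ Z × x ∈ Z × AttrEdge W α σ Z u x) ⊎ (u ∉ Z × (x ∈ Z ⊎ (x ∉ Z × Never u x)))
        classify {u} {x} edge' with u ∈? A | u ∈? Z
        ... | yes u∈A | _ = inj₁ u∈A
        ... | no u∉A | yes u∈Z =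
          let old = old-edge {σ' = σ'} u∈Z u∉A (trans (sym (upd-≢ σ v w (≢v u∈Z)))) edge'
          in inj₂ (inj₁ (u∈Z , proj₁ (proj₂ old) , old))
        ... | no u∉A | no u∉Z with x∈p∪⁅y⁆⁻ (proj₁ edge') | proj₂ (proj₂ edge')
        ...   | inj₁ u∈Z  | _ = absurd (u∉Z u∈Z)
        ...   | inj₂ refl | inj₁ (_ , σ'v) =
                  inj₂ (inj₂ (u∉Z , inj₁ (subst (_∈ Z) (Maybe.just-injective (trans (sym (upd-≡ σ v w)) σ'v)) w∈Z)))
        ...   | inj₂ refl | inj₂ (v-ᾱ , _) = absurd (owned-by-both v-α v-ᾱ)

      ᾱ-step : owner v ≡ opp α → (∀ w → w ∈ W → Edge G v w → w ∈ Z) →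
               AttractorInvariant W A α p Z' σ
      ᾱ-step v-ᾱ succ⊆Z = record
        { pr≤top = pr≤top ; pr-A = pr-A ; parity-p = parity-p
        ; A⊆Z = λ x x∈A → Z⊆Z' (A⊆Z x x∈A) ; Z⊆W = Z'⊆W
        ; σ-sound = λ u x σu → let (u∈ , x∈ , u-α , e) = σ-sound u x σu in Z⊆Z' u∈ , Z⊆Z' x∈ , u-α , e
        ; σ-total = σ'-total ; ᾱ-closed = ᾱ-closed'
        ; cycles = cycles-after Z'⊆W classify never-cycles }
        where
        σ'-total : ∀ u → u ∈ Z' → u ∉ A → owner u ≡ α → ∃ λ x → σ u ≡ just x
        σ'-total u u∈ u∉A u-α with x∈p∪⁅y⁆⁻ u∈
        ... | inj₂ refl = absurd (owned-by-both u-α v-ᾱ)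
        ... | inj₁ u∈Z  = σ-total u u∈Z u∉A u-α

        ᾱ-closed' : ∀ u → u ∈ Z' → u ∉ A → owner u ≡ opp α → ∀ x → x ∈ W → Edge G u x → x ∈ Z'
        ᾱ-closed' u u∈ u∉A u-ᾱ x x∈W e with x∈p∪⁅y⁆⁻ u∈
        ... | inj₂ refl = Z⊆Z' (succ⊆Z x x∈W e)
        ... | inj₁ u∈Z  = Z⊆Z' (ᾱ-closed u u∈Z u∉A u-ᾱ x x∈W e)

        classify : ∀ {u x} → AttrEdge W α σ Z' u x →
          u ∈ A ⊎ (u ∈ Z × x ∈ Z × AttrEdge W α σ Z u x) ⊎ (u ∉ Z × (x ∈ Z ⊎ (x ∉ Z × Never u x)))
        classify {u} {x} edge' with u ∈? A | u ∈? Z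
        ... | yes u∈A | _ = inj₁ u∈A
        ... | no u∉A | yes u∈Z =
          let old = old-edge {σ' = σ} u∈Z u∉A (λ σu → σu) edge'
          in inj₂ (inj₁ (u∈Z , proj₁ (proj₂ old) , old))
        ... | no u∉A | no u∉Z with x∈p∪⁅y⁆⁻ (proj₁ edge') | proj₂ (proj₂ edge')
        ...   | inj₁ u∈Z  | _ = absurd (u∉Z u∈Z)
        ...   | inj₂ refl | inj₁ (v-α , _) = absurd (owned-by-both v-α v-ᾱ)
        ...   | inj₂ refl | inj₂ (_ , x∈W , e) = inj₂ (inj₂ (u∉Z , inj₁ (succ⊆Z x x∈W e)))

    A-step : ∀ {v w} → v ∈ A → owner v ≡ α → w ∈ Z → Edge G v w →
             AttractorInvariant W A α p Z (upd G σ v w)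
    A-step {v} {w} v∈A v-α w∈Z e = record
      { pr≤top = pr≤top ; pr-A = pr-A ; parity-p = parity-p ; A⊆Z = A⊆Z ; Z⊆W = Z⊆W
      ; σ-sound = σ'-sound
      ; σ-total = λ u u∈Z u∉A u-α →
          let (x , σu) = σ-total u u∈Z u∉A u-α in x , trans (upd-≢ σ v w (≢v u∉A)) σu
      ; ᾱ-closed = ᾱ-closed
      ; cycles = cycles-after Z⊆W classify never-cycles }
      where
      σ' = upd G σ v w

      ≢v : ∀ {u} → u ∉ A → u ≢ v
      ≢v u∉A refl = u∉A v∈A

      σ'-sound : ∀ u x → σ' u ≡ just x → u ∈ Z × x ∈ Z × owner u ≡ α × Edge G u x
      σ'-sound u x σ'u with upd-just⁻ σ v w σ'u
      ... | inj₁ (refl , refl) = A⊆Z v v∈A , w∈Z , v-α , e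
      ... | inj₂ (_ , σu) = σ-sound u x σu

      classify : ∀ {u x} → AttrEdge W α σ' Z u x →
        u ∈ A ⊎ (u ∈ Z × x ∈ Z × AttrEdge W α σ Z u x) ⊎ (u ∉ Z × (x ∈ Z ⊎ (x ∉ Z × Never u x)))
      classify {u} edge' with u ∈? A
      ... | yes u∈A = inj₁ u∈A
      ... | no u∉A =
        let old = old-edge {σ' = σ'} (proj₁ edge') u∉A (trans (sym (upd-≢ σ v w (≢v u∉A)))) edge'
        in inj₂ (inj₁ (proj₁ edge' , proj₁ (proj₂ old) , old))

    module _ (t : TC G) (tangle : IsTangle G t) (t⊆W : tset t ⊆ W)
             (t-α : ∃ λ q → IsMaxPr G (tset t) q × parity q ≡ α)
             (escapes⊆Z : ∀ v → ET G W α t v → v ∈ Z) where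
      private
        U = tset t
        τ = tstrat t
        Z' = Z ∪ U
        σ' = extend G σ τ
        open IsTangle tangle using (top; maxPr; stratDom; stratCod)

        parity-top : parity top ≡ α
        parity-top = let (q , q-max , q-α) = t-α in trans (cong parity (IsMaxPr-unique maxPr q-max)) q-α

        Z'⊆W : ∀ x → x ∈ Z' → x ∈ W
        Z'⊆W x x∈ with x∈p∪q⁻ Z U x∈
        ... | inj₁ x∈Z = Z⊆W x x∈Z
        ... | inj₂ x∈U = t⊆W x∈U

        σ'-sound : ∀ u x → σ' u ≡ just x → u ∈ Z' × x ∈ Z' × owner u ≡ α × Edge G u x
        σ'-sound u x σ'u with extend-just⁻ σ τ σ'u
        ... | inj₁ σu = let (u∈ , x∈ , u-α , e) = σ-sound u x σu in p⊆p∪q U u∈ , p⊆p∪q U x∈ , u-α , e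
        ... | inj₂ (_ , τu) =
          let (u∈ , u-top , x∈ , e) = stratCod u x τu in q⊆p∪q Z U u∈ , q⊆p∪q Z U x∈ , trans u-top parity-top , e

        σ-total-Z : ∀ {u} → u ∈ Z → u ∉ A → owner u ≡ α → σ u ≢ nothing
        σ-total-Z u∈Z u∉A u-α σu with σ-total _ u∈Z u∉A u-α
        ... | _ , σu' with () ← trans (sym σu) σu'

        σ'-total : ∀ u → u ∈ Z' → u ∉ A → owner u ≡ α → ∃ λ x → σ' u ≡ just x
        σ'-total u u∈ u∉A u-α with σ u in σu | x∈p∪q⁻ Z U u∈
        ... | just x  | _ = x , refl
        ... | nothing | inj₁ u∈Z = absurd (σ-total-Z u∈Z u∉A u-α σu)
        ... | nothing | inj₂ u∈U = stratDom u u∈U (trans u-α (sym parity-top))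

        ᾱ-closed' : ∀ u → u ∈ Z' → u ∉ A → owner u ≡ opp α → ∀ x → x ∈ W → Edge G u x → x ∈ Z'
        ᾱ-closed' u u∈ u∉A u-ᾱ x x∈W e with x∈p∪q⁻ Z U u∈ | x ∈? U
        ... | inj₁ u∈Z | _        = p⊆p∪q U (ᾱ-closed u u∈Z u∉A u-ᾱ x x∈W e)
        ... | inj₂ _   | yes x∈U = q⊆p∪q Z U x∈U
        ... | inj₂ u∈U | no x∉U  = p⊆p∪q U (escapes⊆Z x (x∈W , x∉U , u , u∈U , u-ᾱ , e))

        TangleEdge : Rel (Fin m) 0ℓ
        TangleEdge = TEdge G U (parity top) τ

        σ'-old : ∀ {u x} → u ∈ Z → u ∉ A → σ' u ≡ just x → σ u ≡ just x
        σ'-old {u} {x} u∈Z u∉A σ'u with extend-just⁻ σ τ σ'u | ownership α u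
        ... | inj₁ σu      | _       = σu
        ... | inj₂ (σu , _) | inj₁ u-α = absurd (σ-total-Z u∈Z u∉A u-α σu)
        ... | inj₂ _        | inj₂ u-ᾱ = absurd (owned-by-both (proj₁ (proj₂ (proj₂ (σ'-sound u x σ'u)))) u-ᾱ)

        classify : ∀ {u x} → AttrEdge W α σ' Z' u x →
          u ∈ A ⊎ (u ∈ Z × x ∈ Z × AttrEdge W α σ Z u x) ⊎ (u ∉ Z × (x ∈ Z ⊎ (x ∉ Z × TangleEdge u x)))
        classify {u} {x} edge' with u ∈? A | u ∈? Z
        ... | yes u∈A | _ = inj₁ u∈A
        ... | no u∉A | yes u∈Z =
          let old = old-edge {σ' = σ'} u∈Z u∉A (σ'-old u∈Z u∉A) edge' in inj₂ (inj₁ (u∈Z , proj₁ (proj₂ old) , old))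
        ... | no u∉A | no u∉Z with x ∈? Z
        ...   | yes x∈Z = inj₂ (inj₂ (u∉Z , inj₁ x∈Z))
        ...   | no x∉Z = inj₂ (inj₂ (u∉Z , inj₂ (x∉Z , tangle-edge (x∈p∪q⁻ Z U (proj₁ edge')) (proj₂ (proj₂ edge')))))
          where
          tangle-edge : u ∈ Z ⊎ u ∈ U → (owner u ≡ α × σ' u ≡ just x) ⊎ (owner u ≡ opp α × x ∈ W × Edge G u x) →
                        TangleEdge u x
          tangle-edge (inj₁ u∈Z) _ = absurd (u∉Z u∈Z)
          tangle-edge (inj₂ u∈U) (inj₁ (u-α , σ'u)) with extend-just⁻ σ τ σ'u
          ... | inj₁ σu = absurd (u∉Z (proj₁ (σ-sound u x σu)))
          ... | inj₂ (_ , τu) = let (_ , _ , x∈U , e) = stratCod u x τu in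
                                u∈U , x∈U , e , inj₁ (trans u-α (sym parity-top) , τu)
          tangle-edge (inj₂ u∈U) (inj₂ (u-ᾱ , x∈W , e)) with x ∈? U
          ... | yes x∈U = u∈U , x∈U , e , inj₂ (trans u-ᾱ (cong opp (sym parity-top)))
          ... | no x∉U  = absurd (x∉Z (escapes⊆Z x (x∈W , x∉U , u , u∈U , u-ᾱ , e)))

      tangle-step : AttractorInvariant W A α p Z' σ'
      tangle-step = record
        { pr≤top = pr≤top ; pr-A = pr-A ; parity-p = parity-p
        ; A⊆Z = λ x x∈A → p⊆p∪q U (A⊆Z x x∈A) ; Z⊆W = Z'⊆W
        ; σ-sound = σ'-sound ; σ-total = σ'-total ; ᾱ-closed = ᾱ-closed'
        ; cycles = cycles-after Z'⊆W classify (λ u k cycle → trans (IsTangle.cycles tangle u k cycle) parity-top) }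

  attractor-step-preserves : ∀ {W T α A p Z σ Z' σ'} → All (IsTangle G) T →
    AttractorInvariant W A α p Z σ → AttrStep G W T α A (Z , σ) (Z' , σ') → AttractorInvariant W A α p Z' σ'
  attractor-step-preserves _ I (stepα v∈W v∉Z v-α w∈W w∈Z e) = AttractorSteps.α-step I v∈W v∉Z v-α w∈W w∈Z e
  attractor-step-preserves _ I (stepᾱ v∈W v∉Z v-ᾱ succ⊆Z) = AttractorSteps.ᾱ-step I v∈W v∉Z v-ᾱ succ⊆Z
  attractor-step-preserves _ I (stepA v∈A v-α _ _ w∈Z e) = AttractorSteps.A-step I v∈A v-α w∈Z e
  attractor-step-preserves tangles I (stepT t t∈T t⊆W t-α _ escapes⊆Z _) =
    AttractorSteps.tangle-step I t (All.lookup tangles t∈T) t⊆W t-α escapes⊆Z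

  escape? : ∀ W α t v → Dec (ET G W α t v)
  escape? W α t v = v ∈? W ×-dec ¬? (v ∈? tset t) ×-dec
    Fin.any? (λ u → u ∈? tset t ×-dec (owner u ≟ₚ opp α) ×-dec edge? u v)

  module _ (W : Subset m) (T : List (TC G)) (α : Player) (A Z : Subset m) (σ : Strat G) where
    private
      AttractsTo : Fin m → Set
      AttractsTo v = ∃ λ w → w ∈ W × w ∈ Z × Edge G v w

      attracts? : ∀ v → Dec (AttractsTo v)
      attracts? v = Fin.any? λ w → w ∈? W ×-dec w ∈? Z ×-dec edge? v w

      αCandidate : Fin m → Set
      αCandidate v = v ∈ W × v ∉ Z × owner v ≡ α × AttractsTo v

      ᾱCandidate : Fin m → Set
      ᾱCandidate v = v ∈ W × v ∉ Z × owner v ≡ opp α × (∀ w → w ∈ W → Edge G v w → w ∈ Z)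

      ACandidate : Fin m → Set
      ACandidate v = v ∈ A × owner v ≡ α × σ v ≡ nothing × AttractsTo v

      TangleCandidate : TC G → Set
      TangleCandidate t = tset t ⊆ W × (∃ λ q → IsMaxPr G (tset t) q × parity q ≡ α) ×
        (∃ λ v → ET G W α t v) × (∀ v → ET G W α t v → v ∈ Z) × (∃ λ u → u ∈ tset t × u ∉ Z)

      tangle-candidate? : ∀ t → Dec (TangleCandidate t)
      tangle-candidate? t = tset t ⊆? W ×-dec max-pr-parity? (tset t) α ×-dec Fin.any? (escape? W α t) ×-dec
        Fin.all? (λ v → escape? W α t v →-dec v ∈? Z) ×-dec Fin.any? (λ u → u ∈? tset t ×-dec ¬? (u ∈? Z))

    attractor-step? : (∃ λ s' → AttrStep G W T α A (Z , σ) s') ⊎ AttrDone G W T α A (Z , σ)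
    attractor-step?
      with Fin.any? {P = αCandidate} (λ v → v ∈? W ×-dec ¬? (v ∈? Z) ×-dec (owner v ≟ₚ α) ×-dec attracts? v)
    ... | yes (v , v∈W , v∉Z , v-α , w , w∈W , w∈Z , e) = inj₁ (_ , stepα v∈W v∉Z v-α w∈W w∈Z e)
    ... | no ¬α with Fin.any? {P = ᾱCandidate} (λ v → v ∈? W ×-dec ¬? (v ∈? Z) ×-dec (owner v ≟ₚ opp α) ×-dec
                                 Fin.all? (λ w → w ∈? W →-dec edge? v w →-dec w ∈? Z))
    ...   | yes (v , v∈W , v∉Z , v-ᾱ , succ⊆Z) = inj₁ (_ , stepᾱ v∈W v∉Z v-ᾱ succ⊆Z)
    ...   | no ¬ᾱ with Fin.any? {P = ACandidate} (λ v → v ∈? A ×-dec (owner v ≟ₚ α) ×-dec undefined? σ v ×-dec attracts? v)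
    ...     | yes (v , v∈A , v-α , σv , w , w∈W , w∈Z , e) = inj₁ (_ , stepA v∈A v-α σv w∈W w∈Z e)
    ...     | no ¬A with Any.any? tangle-candidate? T
    ...       | yes some = let (t , t∈T , (t⊆W , t-α , escape , escapes⊆Z , new)) = find some in
                           inj₁ (_ , stepT t t∈T t⊆W t-α escape escapes⊆Z new)
    ...       | no none = inj₂ stuck
      where
      stuck : AttrDone G W T α A (Z , σ)
      stuck _ (stepα {v = v} {w} v∈W v∉Z v-α w∈W w∈Z e) = ¬α (v , v∈W , v∉Z , v-α , w , w∈W , w∈Z , e)
      stuck _ (stepᾱ {v = v} v∈W v∉Z v-ᾱ succ⊆Z) = ¬ᾱ (v , v∈W , v∉Z , v-ᾱ , succ⊆Z)
      stuck _ (stepA {v = v} {w} v∈A v-α σv w∈W w∈Z e) = ¬A (v , v∈A , v-α , σv , w , w∈W , w∈Z , e)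
      stuck _ (stepT t t∈T t⊆W t-α escape escapes⊆Z new) = none (lose t∈T (t⊆W , t-α , escape , escapes⊆Z , new))

  module _ (W : Subset m) (α : Player) (Z : Subset m) (σ : Strat G) where
    private
      Keeps : Subset m → Fin m → Set
      Keeps X v = (owner v ≡ opp α × (∀ w → w ∈ W → Edge G v w → w ∈ X)) ⊎
                  (owner v ≡ α × ∃ λ w → σ v ≡ just w × w ∈ X)

      keeps? : ∀ X v → Dec (Keeps X v)
      keeps? X v = ((owner v ≟ₚ opp α) ×-dec Fin.all? (λ w → w ∈? W →-dec edge? v w →-dec w ∈? X)) ⊎-dec
                   ((owner v ≟ₚ α) ×-dec Fin.any? (λ w → chooses? σ v w ×-dec w ∈? X))

      keeps-mono : ∀ {X Y} → X ⊆ Y → ∀ {v} → Keeps X v → Keeps Y v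
      keeps-mono X⊆Y (inj₁ (v-ᾱ , succ⊆X)) = inj₁ (v-ᾱ , λ w w∈W e → X⊆Y (succ⊆X w w∈W e))
      keeps-mono X⊆Y (inj₂ (v-α , w , σv , w∈X)) = inj₂ (v-α , w , σv , X⊆Y w∈X)

      kept? : ∀ X v → Dec (v ∈ X × Keeps X v)
      kept? X v = v ∈? X ×-dec keeps? X v

      shrink : Subset m → Subset m
      shrink X = select (kept? X)

      Violated : Subset m → Set
      Violated X = ∃ λ v → v ∈ X × ¬ Keeps X v

      shrinks : ∀ X → Violated X → ∣ shrink X ∣ < ∣ X ∣
      shrinks X (v , v∈X , ¬keeps) =
        p⊂q⇒∣p∣<∣q∣ (proj₁ ∘ ∈-select⁻ (kept? X) , v , v∈X , ¬keeps ∘ proj₂ ∘ ∈-select⁻ (kept? X))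

      Bounds : Subset m → Set
      Bounds X = X ⊆ Z × (∀ X' → PostFix G W α Z σ X' → X' ⊆ X)

      bounds-shrink : ∀ X → Bounds X → Bounds (shrink X)
      bounds-shrink X (X⊆Z , greatest) =
        X⊆Z ∘ proj₁ ∘ ∈-select⁻ (kept? X) ,
        λ X' post v∈ → ∈-select⁺ (kept? X) (greatest X' post v∈ , keeps-mono (greatest X' post) (proj₂ (post _ v∈)))

    greatest-fixpoint : ∃ λ X → IsGFP G W α Z σ X
    greatest-fixpoint
      with iterate-until-stuck shrink ∣_∣ (λ X → Fin.any? λ v → v ∈? X ×-dec ¬? (keeps? X v)) shrinks bounds-shrink
             Z ((λ v∈ → v∈) , λ X' post v∈ → proj₁ (post _ v∈))
    ... | X , (X⊆Z , greatest) , stable = X , post , pre , greatest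
      where
      keeps : ∀ v → v ∈ X → Keeps X v
      keeps v v∈X with keeps? X v
      ... | yes k = k
      ... | no ¬k = absurd (stable (v , v∈X , ¬k))

      post : PostFix G W α Z σ X
      post v v∈X = X⊆Z v∈X , keeps v v∈X

      pre : PreFix G W α Z σ X
      pre v v∈Z k = greatest (X ∪ ⁅ v ⁆) post' (q⊆p∪q X _ (x∈⁅x⁆ v))
        where
        post' : PostFix G W α Z σ (X ∪ ⁅ v ⁆)
        post' y y∈ with x∈p∪⁅y⁆⁻ y∈
        ... | inj₁ y∈X = X⊆Z y∈X , keeps-mono (p⊆p∪q _) (keeps y y∈X)
        ... | inj₂ refl = v∈Z , keeps-mono (p⊆p∪q _) k

  hedge? : ∀ W α σ X u w → Dec (HEdge G W α σ X u w)
  hedge? W α σ X u w = u ∈? X ×-dec w ∈? X ×-dec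
    (((owner u ≟ₚ opp α) ×-dec w ∈? W ×-dec edge? u w) ⊎-dec ((owner u ≟ₚ α) ×-dec chooses? σ u w))

  nbscc? : ∀ W α σ X C → Dec (NBSCC G W α σ X C)
  nbscc? W α σ X C = C ⊆? X ×-dec
    Fin.any? (λ u → Fin.any? λ w → u ∈? C ×-dec w ∈? C ×-dec hedge? W α σ X u w) ×-dec
    Fin.all? (λ u → Fin.all? λ w → u ∈? C →-dec w ∈? C →-dec Reachability.star? (hedge? W α σ X) u w) ×-dec
    Fin.all? (λ u → Fin.all? λ w → u ∈? C →-dec hedge? W α σ X u w →-dec w ∈? C)

  extract : ∀ W α Z σ → ∃ λ L → Extract G W α Z σ L
  extract W α Z σ with greatest-fixpoint W α Z σ
  ... | X , gfp = filter (nbscc? W α σ X) (subsets m) , X , gfp ,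
                  (λ C C∈ → proj₂ (∈-filter⁻ (nbscc? W α σ X) {xs = subsets m} C∈)) ,
                  (λ C nbscc → ∈-filter⁺ (nbscc? W α σ X) (∈-subsets C) nbscc)

  module ExtractedTangle {W A : Subset m} {α : Player} {p : ℕ} {Z : Subset m} {σ : Strat G}
                         (I : AttractorInvariant W A α p Z σ) {X : Subset m} (gfp : IsGFP G W α Z σ X)
                         {C : Subset m} (nbscc : NBSCC G W α σ X C) where
    open AttractorInvariant I

    private
      post : PostFix G W α Z σ X
      post = proj₁ gfp

      strongly-connected : ∀ u w → u ∈ C → w ∈ C → Star (HEdge G W α σ X) u w
      strongly-connected = proj₁ (proj₂ (proj₂ nbscc))

      bottom : ∀ u w → u ∈ C → HEdge G W α σ X u w → w ∈ C
      bottom = proj₂ (proj₂ (proj₂ nbscc))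

      CEdge : Rel (Fin m) 0ℓ
      CEdge u w = u ∈ C × w ∈ C × HEdge G W α σ X u w

      star-in-C : ∀ {u w} → u ∈ C → Star (HEdge G W α σ X) u w → Star CEdge u w
      star-in-C u∈ ε = ε
      star-in-C u∈ (e ◅ path) = (u∈ , bottom _ _ u∈ e , e) ◅ star-in-C (bottom _ _ u∈ e) path

    C⊆X : ∀ {v} → v ∈ C → v ∈ X
    C⊆X = proj₁ nbscc

    X⊆Z : ∀ {v} → v ∈ X → v ∈ Z
    X⊆Z v∈ = proj₁ (post _ v∈)

    private
      CEdge⇒AttrEdge : ∀ {u w} → CEdge u w → AttrEdge W α σ Z u w
      CEdge⇒AttrEdge (_ , _ , u∈X , w∈X , inj₁ (u-ᾱ , w∈W , e)) = X⊆Z u∈X , X⊆Z w∈X , inj₂ (u-ᾱ , w∈W , e)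
      CEdge⇒AttrEdge (_ , _ , u∈X , w∈X , inj₂ (u-α , σu)) = X⊆Z u∈X , X⊆Z w∈X , inj₁ (u-α , σu)

      max-C : ∃ λ q → IsMaxPr G C q
      max-C with max-pr? C | proj₁ (proj₂ nbscc)
      ... | inj₁ max   | _ = max
      ... | inj₂ empty | (u , _ , u∈C , _) = absurd (empty u u∈C)

    q : ℕ
    q = proj₁ max-C

    q-max : IsMaxPr G C q
    q-max = proj₂ max-C

    -- Strong connectivity closes an edge of C and a vertex of top priority q into one cycle.
    parity-q : parity q ≡ α
    parity-q =
      let (u , u∈C , pr-u) = proj₁ q-max
          (a , b , a∈C , b∈C , e) = proj₁ (proj₂ nbscc)
          (k , cycle) = PathMax-via (star-in-C u∈C (strongly-connected u a u∈C a∈C)) (a∈C , b∈C , e)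
                                    (star-in-C b∈C (strongly-connected b u b∈C u∈C))
          q≤k = subst (_≤ k) pr-u (PathMax-pr≤ cycle)
          k≤q = PathMax-≤ (λ (u∈ , w∈ , _) → proj₂ q-max _ u∈ , proj₂ q-max _ w∈) cycle
      in trans (cong parity (ℕ.≤-antisym q≤k k≤q)) (cycles u k (PathMax-map CEdge⇒AttrEdge cycle))

    tangle : TC G
    tangle = tc C (restrict G σ C)

    private
      σC = restrict G σ C

      strat-dom : ∀ u → u ∈ C → owner u ≡ parity q → ∃ λ w → σC u ≡ just w
      strat-dom u u∈C u-q with proj₂ (post u (C⊆X u∈C))
      ... | inj₁ (u-ᾱ , _) = absurd (owned-by-both (trans u-q parity-q) u-ᾱ)
      ... | inj₂ (_ , w , σu , _) = w , trans (restrict-∈ σ C u∈C) σu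

      strat-cod : ∀ u w → σC u ≡ just w → u ∈ C × owner u ≡ parity q × w ∈ C × Edge G u w
      strat-cod u w σCu with restrict-just⁻ σ C σCu
      ... | u∈C , σu with σ-sound u w σu
      ...   | _ , _ , u-α , e =
        u∈C , trans u-α (sym parity-q) , bottom u w u∈C (C⊆X u∈C , w∈X , inj₂ (u-α , σu)) , e
        where
        w∈X : w ∈ X
        w∈X with proj₂ (post u (C⊆X u∈C))
        ... | inj₁ (u-ᾱ , _) = absurd (owned-by-both u-α u-ᾱ)
        ... | inj₂ (_ , w' , σu' , w'∈X) = subst (_∈ X) (Maybe.just-injective (trans (sym σu') σu)) w'∈X

      CEdge⇒TEdge : ∀ {u w} → CEdge u w → TEdge G C (parity q) σC u w
      CEdge⇒TEdge (u∈C , w∈C , _ , _ , inj₁ (u-ᾱ , _ , e)) = u∈C , w∈C , e , inj₂ (trans u-ᾱ (cong opp (sym parity-q)))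
      CEdge⇒TEdge {u} {w} (u∈C , w∈C , _ , _ , inj₂ (u-α , σu)) =
        u∈C , w∈C , proj₂ (proj₂ (proj₂ (σ-sound u w σu))) , inj₁ (trans u-α (sym parity-q) , trans (restrict-∈ σ C u∈C) σu)

      TEdge⇒AttrEdge : ∀ {u w} → TEdge G C (parity q) σC u w → AttrEdge W α σ Z u w
      TEdge⇒AttrEdge (u∈C , w∈C , e , inj₁ (u-q , σCu)) =
        X⊆Z (C⊆X u∈C) , X⊆Z (C⊆X w∈C) , inj₁ (trans u-q parity-q , proj₂ (restrict-just⁻ σ C σCu))
      TEdge⇒AttrEdge {w = w} (u∈C , w∈C , e , inj₂ u-q̄) =
        X⊆Z (C⊆X u∈C) , X⊆Z (C⊆X w∈C) , inj₂ (trans u-q̄ (cong opp parity-q) , Z⊆W w (X⊆Z (C⊆X w∈C)) , e)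

    isTangle : IsTangle G tangle
    isTangle = record
      { top = q
      ; maxPr = q-max
      ; stratDom = strat-dom
      ; stratCod = strat-cod
      ; strong = λ u w u∈ w∈ → Star-map CEdge⇒TEdge (star-in-C u∈ (strongly-connected u w u∈ w∈))
      ; cycles = λ u k cycle → trans (cycles u k (PathMax-map TEdge⇒AttrEdge cycle)) (sym parity-q) }

    no-escape-in-subgame : ∀ v → ¬ ET G W α tangle v
    no-escape-in-subgame v (v∈W , v∉C , u , u∈C , u-ᾱ , e) with proj₂ (post u (C⊆X u∈C))
    ... | inj₂ (u-α , _) = owned-by-both u-α u-ᾱ
    ... | inj₁ (_ , succ⊆X) = v∉C (bottom u v u∈C (C⊆X u∈C , succ⊆X v v∈W e , inj₁ (u-ᾱ , v∈W , e)))

  module _ {R : Rel (Fin m) 0ℓ} (π : ℕ → Fin m) (step : ∀ j → R (π j) (π (suc j))) {p : ℕ}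
           (infinitely-often : ∀ i → ∃ λ j → i ≤ j × pr (π j) ≡ p)
           {i₀ : ℕ} (eventually-≤ : ∀ j → i₀ ≤ j → pr (π j) ≤ p) where
    private
      occurrence : ℕ → ℕ
      occurrence zero    = proj₁ (infinitely-often i₀)
      occurrence (suc k) = proj₁ (infinitely-often (suc (occurrence k)))

      pr-occurrence : ∀ k → pr (π (occurrence k)) ≡ p
      pr-occurrence zero    = proj₂ (proj₂ (infinitely-often i₀))
      pr-occurrence (suc k) = proj₂ (proj₂ (infinitely-often (suc (occurrence k))))

      occurrence-< : ∀ k → occurrence k < occurrence (suc k)
      occurrence-< k = proj₁ (proj₂ (infinitely-often (suc (occurrence k))))

      i₀≤occurrence : ∀ k → i₀ ≤ occurrence k
      i₀≤occurrence zero    = proj₁ (proj₂ (infinitely-often i₀))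
      i₀≤occurrence (suc k) = ℕ.≤-trans (i₀≤occurrence k) (ℕ.<⇒≤ (occurrence-< k))

      occurrence-mono : ∀ {a b} → a < b → occurrence a < occurrence b
      occurrence-mono {a} {suc b} (s≤s a≤b) with ℕ.m≤n⇒m<n∨m≡n a≤b
      ... | inj₁ a<b  = ℕ.<-trans (occurrence-mono a<b) (occurrence-< b)
      ... | inj₂ refl = occurrence-< b

      BoundedEdge : Rel (Fin m) 0ℓ
      BoundedEdge u w = R u w × pr u ≤ p × pr w ≤ p

      segment : ∀ j → i₀ ≤ j → ∀ d → ∃ λ k → PathMax G BoundedEdge (π j) (π (suc (d + j))) k
      segment j i₀≤j zero = _ , edge (step j , eventually-≤ j i₀≤j , eventually-≤ (suc j) (ℕ.m≤n⇒m≤1+n i₀≤j))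
      segment j i₀≤j (suc d) =
        _ , cons (step j , eventually-≤ j i₀≤j , eventually-≤ (suc j) i₀≤1+j)
                 (subst (λ x → PathMax G BoundedEdge (π (suc j)) (π (suc x)) (proj₁ rest)) (ℕ.+-suc d j)
                        (proj₂ rest))
        where
        i₀≤1+j = ℕ.m≤n⇒m≤1+n i₀≤j
        rest = segment (suc j) i₀≤1+j d

    -- Two of the first m + 1 occurrences of p are at the same vertex; the play between them
    -- is a cycle whose priorities are at most p.
    recurring-cycle : ∃ λ v → PathMax G R v v p
    recurring-cycle =
      let (a , b , a<b , same-vertex) = Fin.pigeonhole (ℕ.n<1+n m) (λ k → π (occurrence (toℕ k)))
          i = occurrence (toℕ a)
          (d , i+d≡) = ℕ.m≤n⇒∃[o]m+o≡n (occurrence-mono a<b)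
          (k , path) = segment i (i₀≤occurrence (toℕ a)) d
          cycle = subst (λ x → PathMax G BoundedEdge (π i) x k)
                        (trans (cong (π ∘ suc) (ℕ.+-comm d i)) (trans (cong π i+d≡) (sym same-vertex))) path
          p≤k = subst (_≤ k) (pr-occurrence (toℕ a)) (PathMax-pr≤ cycle)
          k≤p = PathMax-≤ (λ (_ , u≤p , w≤p) → u≤p , w≤p) cycle
      in π i , subst (PathMax G R (π i) (π i)) (ℕ.≤-antisym k≤p p≤k) (PathMax-map proj₁ cycle)

  module _ (t : TC G) (tangle : IsTangle G t) where
    open IsTangle tangle using (top; stratDom; stratCod)
    private
      α = parity top
      U = tset t
      τ = tstrat t

    module _ (no-escape : ∀ v → ¬ ET G ⊤ α t v) (ρ : Play G) (consistent : Consistent G τ ρ)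
             (starts-in-U : Play.π ρ 0 ∈ U) where
      open Play ρ

      stays-in-U : ∀ i → π i ∈ U
      stays-in-U zero = starts-in-U
      stays-in-U (suc i) with ownership α (π i)
      ... | inj₁ πi-α = let (w , τπi) = stratDom (π i) (stays-in-U i) πi-α
                            (_ , _ , w∈U , _) = stratCod (π i) w τπi
                        in subst (_∈ U) (sym (consistent i w τπi)) w∈U
      ... | inj₂ πi-ᾱ with π (suc i) ∈? U
      ...   | yes ∈U = ∈U
      ...   | no ∉U  = absurd (no-escape (π (suc i)) (∈⊤ , ∉U , π i , stays-in-U i , πi-ᾱ , valid i))

      follows-tangle : ∀ j → TEdge G U α τ (π j) (π (suc j))
      follows-tangle j with ownership α (π j)
      ... | inj₁ πj-α = let (w , τπj) = stratDom (π j) (stays-in-U j) πj-α in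
          stays-in-U j , stays-in-U (suc j) , valid j ,
          inj₁ (πj-α , subst (λ x → τ (π j) ≡ just x) (sym (consistent j w τπj)) τπj)
      ... | inj₂ πj-ᾱ = stays-in-U j , stays-in-U (suc j) , valid j , inj₂ πj-ᾱ

      won-by-tangle-owner : Won G α ρ
      won-by-tangle-owner p infinitely-often (i₀ , eventually-≤) =
        let (v , cycle) = recurring-cycle π follows-tangle infinitely-often eventually-≤
        in IsTangle.cycles tangle v p cycle

    tangle-without-escapes-is-dominion : (∀ v → ¬ ET G ⊤ α t v) → IsDominion G α U
    tangle-without-escapes-is-dominion no-escape =
      τ , (λ u w τu → let (_ , u-α , _ , e) = stratCod u w τu in u-α , e) ,
      λ ρ consistent starts-in-U → stays-in-U no-escape ρ consistent starts-in-U ,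
                                   won-by-tangle-owner no-escape ρ consistent starts-in-U

  NewVertexSet : List (TC G) → TC G → Set
  NewVertexSet T t = ∀ t' → t' ∈ₗ T → tset t' ≢ tset t

  -- escapes-stay holds since a tangle of T escaping only into a finished region would have been
  -- attracted to it.
  record LoopInvariant (T : List (TC G)) (R : Subset m) (Y : List (TC G)) : Set where
    field
      T-tangles     : All (IsTangle G) T
      Y-tangles     : All (IsTangle G) Y
      subgame-total : ∀ v → v ∉ R → ∃ λ w → w ∉ R × Edge G v w
      escapes-stay  : ∀ t → t ∈ₗ T → ∀ q → IsMaxPr G (tset t) q → (∀ u → u ∈ tset t → u ∉ R) →
                      (∃ λ v → ET G ⊤ (parity q) t v × v ∈ R) → ∃ λ v → ET G (∁ R) (parity q) t v
      new-tangle    : (∀ v → v ∈ R) → ∃ λ t → t ∈ₗ Y × NewVertexSet T t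

  Returned : TC G → Set
  Returned t = IsTangle G t × ∃ λ p → IsMaxPr G (tset t) p × IsDominion G (parity p) (tset t)

  SearchInvariant : SState G → Set
  SearchInvariant (loop T R Y)         = LoopInvariant T R Y
  SearchInvariant (attr T R Y p Z σ)   =
    LoopInvariant T R Y × IsMaxPr G (∁ R) p × AttractorInvariant (∁ R) (topSet G R p) (parity p) p Z σ
  SearchInvariant (done _ t)           = Returned t

  fresh-loop : Fin m → ∀ {T} → All (IsTangle G) T → LoopInvariant T ⊥ []
  fresh-loop v₀ T-tangles = record
    { T-tangles = T-tangles ; Y-tangles = []
    ; subgame-total = λ v _ → let (w , e) = total v in w , ∉⊥ , e
    ; escapes-stay = λ { _ _ _ _ _ (_ , _ , v∈⊥) → absurd (∉⊥ v∈⊥) }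
    ; new-tangle = λ full → absurd (∉⊥ (full v₀)) }

  region-start : ∀ {R p} → IsMaxPr G (∁ R) p →
                 AttractorInvariant (∁ R) (topSet G R p) (parity p) p (topSet G R p) (σ∅ G)
  region-start {R} {p} max = record
    { pr≤top = proj₂ max
    ; pr-A = λ v v∈ → proj₂ (∈-topSet⁻ {R} v∈)
    ; parity-p = refl
    ; A⊆Z = λ v v∈ → v∈
    ; Z⊆W = λ v v∈ → x∉p⇒x∈∁p (proj₁ (∈-topSet⁻ {R} v∈))
    ; σ-sound = λ _ _ ()
    ; σ-total = λ u u∈ u∉ _ → absurd (u∉ u∈)
    ; ᾱ-closed = λ u u∈ u∉ _ → absurd (u∉ u∈)
    ; cycles = λ u k cycle → cong parity (ℕ.≤-antisym (k≤p cycle) (p≤k cycle)) }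
    where
    Edge₀ = AttrEdge (∁ R) (parity p) (σ∅ G) (topSet G R p)

    k≤p : ∀ {u k} → PathMax G Edge₀ u u k → k ≤ p
    k≤p = PathMax-≤ λ (u∈ , w∈ , _) → proj₂ max _ (x∉p⇒x∈∁p (proj₁ (∈-topSet⁻ {R} u∈))) ,
                                       proj₂ max _ (x∉p⇒x∈∁p (proj₁ (∈-topSet⁻ {R} w∈)))

    p≤k : ∀ {u k} → PathMax G Edge₀ u u k → p ≤ k
    p≤k cycle@(edge (u∈ , _))   = subst (_≤ _) (proj₂ (∈-topSet⁻ {R} u∈)) (PathMax-pr≤ cycle)
    p≤k cycle@(cons (u∈ , _) _) = subst (_≤ _) (proj₂ (∈-topSet⁻ {R} u∈)) (PathMax-pr≤ cycle)

  ET-set : ∀ {W α t t' v} → tset t ≡ tset t' → ET G W α t v → ET G W α t' v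
  ET-set {v = v} same-set (v∈W , v∉t , u , u∈t , u-ᾱ , e) =
    v∈W , (λ v∈t' → v∉t (subst (v ∈_) (sym same-set) v∈t')) , u , subst (u ∈_) same-set u∈t , u-ᾱ , e

  ET-parity : ∀ {W α β t v} → α ≡ β → ET G W α t v → ET G W β t v
  ET-parity refl escape = escape

  ∈-mkTangles⁻ : ∀ {σ L t} → t ∈ₗ mkTangles G σ L → ∃ λ C → C ∈ₗ L × t ≡ tc C (restrict G σ C)
  ∈-mkTangles⁻ = ∈-map⁻ _

  module FinishedRegion {T : List (TC G)} {R : Subset m} {Y : List (TC G)} {p : ℕ} {Z : Subset m} {σ : Strat G}
                        (LI : LoopInvariant T R Y) (max : IsMaxPr G (∁ R) p)
                        (I : AttractorInvariant (∁ R) (topSet G R p) (parity p) p Z σ) where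
    private
      W = ∁ R
      α = parity p
      A = topSet G R p
      open AttractorInvariant I
      open LoopInvariant LI

    extracted-tangles : ∀ {L} → Extract G W α Z σ L → All (IsTangle G) (mkTangles G σ L)
    extracted-tangles (X , gfp , listed , _) = All.tabulate tangle
      where
      tangle : ∀ {t} → t ∈ₗ mkTangles G σ _ → IsTangle G t
      tangle t∈ with ∈-mkTangles⁻ {σ = σ} t∈
      ... | C , C∈ , refl = ExtractedTangle.isTangle I gfp (listed C C∈)

    returned : ∀ {L t} → Extract G W α Z σ L → t ∈ₗ mkTangles G σ L → (∀ v → ¬ ET G ⊤ α t v) → Returned t
    returned (X , gfp , listed , _) t∈ no-escape with ∈-mkTangles⁻ {σ = σ} t∈
    ... | C , C∈ , refl =
      isTangle , q , q-max ,
      tangle-without-escapes-is-dominion tangle isTangle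
        (λ v e → no-escape v (ET-parity {⊤} {t = tangle} {v} parity-q e))
      where open ExtractedTangle I gfp (listed C C∈)

    module _ (finished : AttrDone G W T α A (Z , σ)) where
      private
        R' = R ∪ Z

        ∉R' : ∀ {v} → v ∉ R → v ∉ Z → v ∉ R'
        ∉R' v∉R v∉Z v∈ with x∈p∪q⁻ R Z v∈
        ... | inj₁ v∈R = v∉R v∈R
        ... | inj₂ v∈Z = v∉Z v∈Z

        ∉R'⁻ : ∀ {v} → v ∉ R' → v ∉ R × v ∉ Z
        ∉R'⁻ v∉ = v∉ ∘ p⊆p∪q Z , v∉ ∘ q⊆p∪q R Z

        ᾱ-attracted : ∀ {v} → v ∈ W → v ∉ Z → owner v ≡ opp α → ∃ λ w → w ∈ W × w ∉ Z × Edge G v w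
        ᾱ-attracted {v} v∈W v∉Z v-ᾱ with Fin.any? (λ w → w ∈? W ×-dec ¬? (w ∈? Z) ×-dec edge? v w)
        ... | yes escape = escape
        ... | no none = absurd (finished _ (stepᾱ v∈W v∉Z v-ᾱ succ⊆Z))
          where
          succ⊆Z : ∀ w → w ∈ W → Edge G v w → w ∈ Z
          succ⊆Z w w∈W e with w ∈? Z
          ... | yes w∈Z = w∈Z
          ... | no w∉Z  = absurd (none (w , w∈W , w∉Z , e))

      subgame-total' : ∀ v → v ∉ R' → ∃ λ w → w ∉ R' × Edge G v w
      subgame-total' v v∉ with ∉R'⁻ v∉ | ownership α v
      ... | v∉R , v∉Z | inj₁ v-α = let (w , w∉R , e) = subgame-total v v∉R in
        w , ∉R' w∉R (λ w∈Z → finished _ (stepα (x∉p⇒x∈∁p v∉R) v∉Z v-α (x∉p⇒x∈∁p w∉R) w∈Z e)) , e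
      ... | v∉R , v∉Z | inj₂ v-ᾱ = let (w , w∈W , w∉Z , e) = ᾱ-attracted (x∉p⇒x∈∁p v∉R) v∉Z v-ᾱ in
        w , ∉R' (x∈∁p⇒x∉p w∈W) w∉Z , e

      module _ {t} (t∈T : t ∈ₗ T) {q} (q-max : IsMaxPr G (tset t) q) (t⊆∁R' : ∀ u → u ∈ tset t → u ∉ R') where
        private
          t⊆W : tset t ⊆ W
          t⊆W u∈ = x∉p⇒x∈∁p (proj₁ (∉R'⁻ (t⊆∁R' _ u∈)))

          t∩Z≡∅ : ∀ {u} → u ∈ tset t → u ∉ Z
          t∩Z≡∅ u∈ = proj₂ (∉R'⁻ (t⊆∁R' _ u∈))

        escape-into-subgame : (∃ λ v → ET G ⊤ (parity q) t v × v ∈ R') → ∃ λ v → ET G W (parity q) t v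
        escape-into-subgame (v , (_ , v∉t , u , u∈t , u-q̄ , e) , v∈R') with x∈p∪q⁻ R Z v∈R'
        ... | inj₁ v∈R = escapes-stay t t∈T q q-max (λ u u∈ → proj₁ (∉R'⁻ (t⊆∁R' u u∈)))
                                        (v , (∈⊤ , v∉t , u , u∈t , u-q̄ , e) , v∈R)
        ... | inj₂ v∈Z = v , Z⊆W v v∈Z , v∉t , u , u∈t , u-q̄ , e

        -- If every escape of t within the subgame were in Z the attractor would not be finished:
        -- for a tangle of α the tangle rule applies, otherwise the escaping vertex belongs to α.
        escape-outside-region : (∃ λ v → ET G W (parity q) t v) → ∃ λ v → ET G (∁ R') (parity q) t v
        escape-outside-region (v , escape) with Fin.any? (λ v → escape? W (parity q) t v ×-dec ¬? (v ∈? Z))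
        ... | yes (v' , (v'∈W , escape') , v'∉Z) = v' , x∉p⇒x∈∁p (∉R' (x∈∁p⇒x∉p v'∈W) v'∉Z) , escape'
        ... | no none with player-cases (parity q) α
        ...   | inj₁ α≡q =
          absurd (finished _ (stepT t t∈T t⊆W (q , q-max , sym α≡q) (v , ET-parity {W} {t = t} {v} (sym α≡q) escape)
                                    escapes⊆Z (let (u , u∈t , _) = proj₁ q-max in u , u∈t , t∩Z≡∅ u∈t)))
          where
          escapes⊆Z : ∀ v → ET G W α t v → v ∈ Z
          escapes⊆Z v escape with v ∈? Z
          ... | yes v∈Z = v∈Z
          ... | no v∉Z  = absurd (none (v , ET-parity {W} {t = t} {v} α≡q escape , v∉Z))
        ...   | inj₂ α≡q̄ with escape
        ...     | (v∈W , _ , u , u∈t , u-q̄ , e) with v ∈? Z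
        ...       | no v∉Z  = absurd (none (v , escape , v∉Z))
        ...       | yes v∈Z = absurd (finished _ (stepα (t⊆W u∈t) (t∩Z≡∅ u∈t) (trans u-q̄ (sym α≡q̄)) v∈W v∈Z e))

      module _ {L : List (Subset m)} (ex : Extract G W α Z σ L)
               (escapes : ∀ t → t ∈ₗ mkTangles G σ L → ∃ λ v → ET G ⊤ α t v) where
        private
          X = proj₁ ex
          gfp = proj₁ (proj₂ ex)
          complete = proj₂ (proj₂ (proj₂ ex))

        module _ (full : ∀ v → v ∈ R') where
          private
            W⊆Z : ∀ v → v ∈ W → v ∈ Z
            W⊆Z v v∈W with x∈p∪q⁻ R Z (full v)
            ... | inj₁ v∈R = absurd (x∈∁p⇒x∉p v∈W v∈R)
            ... | inj₂ v∈Z = v∈Z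

            σ-defined : ∀ v → v ∈ Z → owner v ≡ α → ∃ λ w → σ v ≡ just w
            σ-defined v v∈Z v-α with v ∈? A
            ... | no v∉A = σ-total v v∈Z v∉A v-α
            ... | yes v∈A with σ v in σv
            ...   | just w  = w , refl
            ...   | nothing =
              let (w , w∉R , e) = subgame-total v (proj₁ (∈-topSet⁻ {R} v∈A))
              in absurd (finished _ (stepA v∈A v-α σv (x∉p⇒x∈∁p w∉R) (W⊆Z w (x∉p⇒x∈∁p w∉R)) e))

            Z-post : PostFix G W α Z σ Z
            Z-post v v∈Z with ownership α v
            ... | inj₁ v-α = let (w , σv) = σ-defined v v∈Z v-α in
                             v∈Z , inj₂ (v-α , w , σv , proj₁ (proj₂ (σ-sound v w σv)))
            ... | inj₂ v-ᾱ = v∈Z , inj₁ (v-ᾱ , λ w w∈W _ → W⊆Z w w∈W)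

            Z⊆X : ∀ {v} → v ∈ Z → v ∈ X
            Z⊆X = proj₂ (proj₂ gfp) Z Z-post

            X⊆Z : ∀ {v} → v ∈ X → v ∈ Z
            X⊆Z v∈ = proj₁ (proj₁ gfp _ v∈)

            serial : ∀ u → u ∈ X → ∃ λ w → HEdge G W α σ X u w
            serial u u∈X with ownership α u
            ... | inj₁ u-α = let (w , σu) = σ-defined u (X⊆Z u∈X) u-α in
                             w , u∈X , Z⊆X (proj₁ (proj₂ (σ-sound u w σu))) , inj₂ (u-α , σu)
            ... | inj₂ u-ᾱ = let (w , w∉R , e) = subgame-total u (x∈∁p⇒x∉p (Z⊆W u (X⊆Z u∈X))) in
                             w , u∈X , Z⊆X (W⊆Z w (x∉p⇒x∈∁p w∉R)) , inj₁ (u-ᾱ , x∉p⇒x∈∁p w∉R , e)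

            component : ∃ λ C → NBSCC G W α σ X C
            component =
              let (u , u∈W , pr-u) = proj₁ max in
              Reachability.bottom-component (hedge? W α σ X) (λ (u∈ , w∈ , _) → u∈ , w∈) serial
                (u , Z⊆X (A⊆Z u (∈-topSet⁺ (x∈∁p⇒x∉p u∈W) pr-u)))

            -- An escape of the new tangle must lie in R; a tangle of T with the same vertex set
            -- would then also escape within the subgame, which the new tangle does not.
            new-vertex-set : ∀ C → NBSCC G W α σ X C → NewVertexSet T (tc C (restrict G σ C))
            new-vertex-set C nbscc t' t'∈T same-set
              with escapes tangle (∈-map⁺ (λ C → tc C (restrict G σ C)) (complete C nbscc))
              where open ExtractedTangle I gfp nbscc using (tangle)
            ... | v , escape with v ∈? R
            ...   | no v∉R = no-escape-in-subgame v (x∉p⇒x∈∁p v∉R , proj₂ escape)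
              where open ExtractedTangle I gfp nbscc using (no-escape-in-subgame)
            ...   | yes v∈R =
              let (v' , escape') = escapes-stay t' t'∈T q (subst (λ U → IsMaxPr G U q) (sym same-set) q-max)
                                     (λ u u∈ → x∈∁p⇒x∉p (Z⊆W u (X⊆Z (C⊆X (subst (u ∈_) same-set u∈)))))
                                     (v , ET-set {⊤} {t = tangle} {t'} {v} (sym same-set)
                                                 (ET-parity {⊤} {t = tangle} {v} (sym parity-q) escape) , v∈R)
              in no-escape-in-subgame v'
                   (ET-parity {W} {t = tangle} {v'} parity-q (ET-set {W} {t = t'} {tangle} {v'} same-set escape'))
              where open ExtractedTangle I gfp nbscc using (q; q-max; parity-q; tangle; C⊆X; no-escape-in-subgame)

          new-tangle' : ∃ λ t → t ∈ₗ mkTangles G σ L × NewVertexSet T t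
          new-tangle' = let (C , nbscc) = component in
            tc C (restrict G σ C) , ∈-map⁺ (λ C → tc C (restrict G σ C)) (complete C nbscc) , new-vertex-set C nbscc

        continued : LoopInvariant T R' (Y ++ mkTangles G σ L)
        continued = record
          { T-tangles = T-tangles
          ; Y-tangles = All.++⁺ Y-tangles (extracted-tangles ex)
          ; subgame-total = subgame-total'
          ; escapes-stay = λ t t∈T q q-max t⊆∁R' →
              escape-outside-region t∈T q-max t⊆∁R' ∘ escape-into-subgame t∈T q-max t⊆∁R'
          ; new-tangle = λ full → let (t , t∈ , new) = new-tangle' full in t , ∈-++⁺ʳ Y t∈ , new }

  search-progress : ∀ s → (∃₂ λ T'' t → s ≡ done T'' t) ⊎ (∃ λ s' → SStep G s s')
  search-progress (done T'' t) = inj₁ (T'' , t , refl)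
  search-progress (loop T R Y) with Fin.all? (_∈? R)
  ... | yes full = inj₂ (_ , restart full)
  ... | no ¬full with Fin.¬∀⟶∃¬ m (_∈ R) (_∈? R) ¬full | max-pr? (∁ R)
  ...   | v , v∉R | inj₁ (p , max) = inj₂ (_ , begin (v , v∉R) max)
  ...   | v , v∉R | inj₂ empty     = absurd (empty v (x∉p⇒x∈∁p v∉R))
  search-progress (attr T R Y p Z σ) with attractor-step? (∁ R) T (parity p) (topSet G R p) Z σ
  ... | inj₁ (_ , step) = inj₂ (_ , attrStep step)
  ... | inj₂ finished with extract (∁ R) (parity p) Z σ
  ...   | L , ex with Any.any? (λ t → Fin.all? (λ v → ¬? (escape? ⊤ (parity p) t v))) (mkTangles G σ L)
  ...     | yes closed = let (t , t∈ , no-escape) = find closed in inj₂ (_ , return t finished ex t∈ no-escape)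
  ...     | no ¬closed = inj₂ (_ , continue finished ex escapes)
    where
    escapes : ∀ t → t ∈ₗ mkTangles G σ L → ∃ λ v → ET G ⊤ (parity p) t v
    escapes t t∈ with Fin.any? (escape? ⊤ (parity p) t)
    ... | yes escape = escape
    ... | no none    = absurd (¬closed (lose t∈ λ v escape → none (v , escape)))

  module _ (v₀ : Fin m) where

    search-step-preserves : ∀ {s s'} → SearchInvariant s → SStep G s s' → SearchInvariant s'
    search-step-preserves LI (restart _) =
      fresh-loop v₀ (All.++⁺ (LoopInvariant.T-tangles LI) (LoopInvariant.Y-tangles LI))
    search-step-preserves LI (begin _ max) = LI , max , region-start max
    search-step-preserves (LI , max , I) (attrStep step) =
      LI , max , attractor-step-preserves (LoopInvariant.T-tangles LI) I step
    search-step-preserves (LI , max , I) (return t _ ex t∈ no-escape) = FinishedRegion.returned LI max I ex t∈ no-escape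
    search-step-preserves (LI , max , I) (continue finished ex escapes) =
      FinishedRegion.continued LI max I finished ex escapes

    search-run-preserves : ∀ {s s'} → SearchInvariant s → Star (SStep G) s s' → SearchInvariant s'
    search-run-preserves inv ε = inv
    search-run-preserves inv (step ◅ run) = search-run-preserves (search-step-preserves inv step) run

    private
      Used : List (TC G) → Subset m → Set
      Used T S = Any.Any (λ t → tset t ≡ S) T

      used? : ∀ T → Decidable (Used T)
      used? T S = Any.any? (λ t → Vec.≡-dec Bool._≟_ (tset t) S) T

      unused-vertex-sets : List (TC G) → ℕ
      unused-vertex-sets T = length (filter (¬? ∘ used? T) (subsets m))

      unused-decrease : ∀ T Y → (∃ λ t → t ∈ₗ Y × NewVertexSet T t) →
                        unused-vertex-sets (T ++ Y) < unused-vertex-sets T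
      unused-decrease T Y (t , t∈Y , new) =
        length-filter-¬-strict (used? T) (used? (T ++ Y)) (λ _ → Any.++⁺ˡ) (subsets m) (∈-subsets (tset t))
          (λ used → let (t' , t'∈T , same) = find used in new t' t'∈T same)
          (Any.++⁺ʳ T (lose t∈Y refl))

      undefined-count : Strat G → ℕ
      undefined-count σ = ∣ select (undefined? σ) ∣

      undefined-decrease : ∀ σ v w → σ v ≡ nothing → undefined-count (upd G σ v w) < undefined-count σ
      undefined-decrease σ v w σv =
        p⊂q⇒∣p∣<∣q∣ (still-undefined , v , ∈-select⁺ (undefined? σ) σv , just≢nothing ∘ now-defined)
        where
        just≢nothing : just w ≢ nothing
        just≢nothing ()

        now-defined : v ∈ select (undefined? (upd G σ v w)) → just w ≡ nothing
        now-defined v∈ = trans (sym (upd-≡ σ v w)) (∈-select⁻ (undefined? (upd G σ v w)) v∈)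

        still-undefined : select (undefined? (upd G σ v w)) ⊆ select (undefined? σ)
        still-undefined {u} u∈ with u Fin.≟ v
        ... | yes refl = absurd (just≢nothing (now-defined u∈))
        ... | no u≢v   =
          ∈-select⁺ (undefined? σ) (trans (sym (upd-≢ σ v w u≢v)) (∈-select⁻ (undefined? (upd G σ v w)) u∈))

      region-grows : ∀ {R p Z σ} → IsMaxPr G (∁ R) p →
                     AttractorInvariant (∁ R) (topSet G R p) (parity p) p Z σ → m ∸ ∣ R ∪ Z ∣ < m ∸ ∣ R ∣
      region-grows {R} max I =
        let (u , u∈W , pr-u) = proj₁ max
            u∉R = x∈∁p⇒x∉p u∈W
        in p⊂q⇒m∸∣q∣<m∸∣p∣ (p⊆p∪q _ , u , q⊆p∪q R _ (AttractorInvariant.A⊆Z I u (∈-topSet⁺ u∉R pr-u)) , u∉R)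

      Step⁻ : Rel (SState G) 0ℓ
      Step⁻ s' s = SStep G s s'

      one-more : ∀ {Z : Subset m} v → v ∉ Z → m ∸ ∣ Z ∪ ⁅ v ⁆ ∣ < m ∸ ∣ Z ∣
      one-more {Z} v v∉Z = p⊂q⇒m∸∣q∣<m∸∣p∣ (p⊆p∪q _ , v , q⊆p∪q Z _ (x∈⁅x⁆ v) , v∉Z)

      attr-accessible : ∀ {T R Y p Z σ} → SearchInvariant (attr T R Y p Z σ) →
        (∀ {R' Y'} → m ∸ ∣ R' ∣ < m ∸ ∣ R ∣ → LoopInvariant T R' Y' → Acc Step⁻ (loop T R' Y')) →
        Acc _<_ (m ∸ ∣ Z ∣) → Acc _<_ (undefined-count σ) → Acc Step⁻ (attr T R Y p Z σ)
      attr-accessible {T} {R} {Y} {p} {Z} inv next (acc bigger) = go inv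
        where
        go : ∀ {σ} → SearchInvariant (attr T R Y p Z σ) → Acc _<_ (undefined-count σ) → Acc Step⁻ (attr T R Y p Z σ)
        go {σ} inv@(_ , max , I) (acc fewer) = acc λ where
          st@(attrStep (stepα {v = v} _ v∉Z _ _ _ _)) →
            attr-accessible (search-step-preserves inv st) next (bigger (one-more v v∉Z)) (<-wellFounded _)
          st@(attrStep (stepᾱ {v = v} _ v∉Z _ _)) →
            attr-accessible (search-step-preserves inv st) next (bigger (one-more v v∉Z)) (<-wellFounded _)
          st@(attrStep (stepA {v = v} {w} _ _ σv _ _ _)) →
            go (search-step-preserves inv st) (fewer (undefined-decrease σ v w σv))
          st@(attrStep (stepT t _ _ _ _ _ (u , u∈t , u∉Z))) →
            attr-accessible (search-step-preserves inv st) next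
              (bigger (p⊂q⇒m∸∣q∣<m∸∣p∣ (p⊆p∪q _ , u , q⊆p∪q Z _ u∈t , u∉Z))) (<-wellFounded _)
          (return _ _ _ _ _) → acc λ ()
          st@(continue _ _ _) → next (region-grows max I) (search-step-preserves inv st)

    loop-accessible : ∀ {T R Y} → LoopInvariant T R Y →
      Acc _<_ (unused-vertex-sets T) → Acc _<_ (m ∸ ∣ R ∣) → Acc Step⁻ (loop T R Y)
    loop-accessible {T} LI (acc fewer) = go LI
      where
      go : ∀ {R Y} → LoopInvariant T R Y → Acc _<_ (m ∸ ∣ R ∣) → Acc Step⁻ (loop T R Y)
      go {R} {Y} LI (acc bigger) = acc λ where
        st@(restart full) → loop-accessible (search-step-preserves LI st)
          (fewer (unused-decrease T Y (LoopInvariant.new-tangle LI full))) (<-wellFounded _)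
        st@(begin _ _) → attr-accessible (search-step-preserves LI st)
          (λ R'-bigger LI' → go LI' (bigger R'-bigger)) (<-wellFounded _) (<-wellFounded _)

lemma9 : ∀ {n : ℕ} (G : Game (suc n)) (T : List (TC G)) → All (IsTangle G) T →
  Acc (λ s' s → SStep G s s') (initial G T) ×
  (∀ s → Star (SStep G) (initial G T) s →
     (∃₂ λ T'' t → s ≡ done T'' t) ⊎ (∃ λ s' → SStep G s s')) ×
  (∀ T'' t → Star (SStep G) (initial G T) (done T'' t) →
     IsTangle G t × ∃ λ p → IsMaxPr G (TC.tset t) p × IsDominion G (parity p) (TC.tset t))
lemma9 G T T-tangles =
  loop-accessible zero start (<-wellFounded _) (<-wellFounded _) ,
  (λ s _ → search-progress s) ,
  (λ T'' t run → search-run-preserves zero start run)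
  where
  open Search G
  start = fresh-loop zero T-tangles
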